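{- Let $i,m\geq0$ be integers. (a) There exists a constant $A_{i,m}\in\mathbb{Q}$ (depending only on $i$ and $m$) such that, modulo the ideal $(x+y+m)$ of $\mathbb{Q}[x,y]$, $$2\,\widetilde{f_i^m}(x,y)\equiv A_{i,m}(x+2m+i)_{3m+2i+1}(x+m-1/2)_m\equiv -A_{i,m}(y+2m+i)_{3m+2i+1}(y+m-1/2)_m.$$ (b) There exists a constant $B_{i,m}\in\mathbb{Q}$ (depending only on $i$ and $m$) such that, modulo the ideal $(x+y-m)$ of $\mathbb{Q}[x,y]$, $$2\,\widetilde{f_i^m}(x,y)\equiv B_{i,m}(x+m+i)_{3m+2i+1}(x-1/2)_m\equiv -B_{i,m}(y+m+i)_{3m+2i+1}(y-1/2)_m.$$
   Context: For a number or polynomial $\alpha$ and an integer $k\geq0$, $(\alpha)_k=\alpha(\alpha-1)\cdots(\alpha-k+1)$, $(\alpha)_0=1$. For integers $i,m\geq0$ put $$f_i^m(x,y)=\int_0^x t^{2i}(t^2-x^2)^m(t^2-y^2)^m\,dt,$$ and set $p=2m+i$. Then $f_i^m(x,y)=\sum_{0\leq k\leq m}c_{m,i,k}\,x^{2p-2k+1}y^{2k}$ for uniquely determined rational constants $c_{m,i,k}$. Define $$\widetilde{f_i^m}(x,y)=\sum_{0\leq k\leq m}c_{m,i,k}\,(x+p-k)_{2p-2k+1}\,(y+p-m)_k\,(y+m-p+k-1)_k .$$ -}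

module Defs where

open import Data.Nat as ℕ using (ℕ; zero; suc)
open import Data.Nat.Combinatorics using (_C_)
open import Data.Integer using (ℤ; +_)
open import Data.Rational using (ℚ; _+_; _*_; _-_; -_; _/_; 0ℚ; 1ℚ)

ℕ→ℚ : ℕ → ℚ
ℕ→ℚ n = + n / 1

-- falling factorial (a)_k = a (a-1) ... (a-k+1), (a)_0 = 1
ff : ℚ → ℕ → ℚ
ff a zero    = 1ℚ
ff a (suc k) = ff a k * (a - ℕ→ℚ k)

sumTo : ℕ → (ℕ → ℚ) → ℚ
sumTo zero    f = f 0
sumTo (suc n) f = sumTo n f + f (suc n)

sgn : ℕ → ℚ
sgn zero    = 1ℚ
sgn (suc n) = - sgn n

-- c_{m,i,k}: coefficient of x^{2p-2k+1} y^{2k} in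
--   f_i^m(x,y) = ∫_0^x t^{2i} (t²-x²)^m (t²-y²)^m dt ,  p = 2m+i,
-- obtained by expanding (t²-x²)^m = Σ_a C(m,a) t^{2a} (-x²)^{m-a},
-- (t²-y²)^m = Σ_b C(m,b) t^{2b} (-y²)^{m-b} and integrating termwise;
-- the power y^{2k} corresponds to b = m - k.  (Used only for k ≤ m.)
coef : ℕ → ℕ → ℕ → ℚ
coef m i k = sumTo m λ a →
  let b = m ℕ.∸ k in
  sgn (a ℕ.+ b) * ℕ→ℚ ((m C a) ℕ.* (m C b))
    * ((+ 1) / suc (2 ℕ.* i ℕ.+ 2 ℕ.* a ℕ.+ 2 ℕ.* b))

pp : ℕ → ℕ → ℕ
pp m i = 2 ℕ.* m ℕ.+ i

ftilde : ℕ → ℕ → ℚ → ℚ → ℚ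
ftilde m i x y = sumTo m λ k →
  coef m i k
  * ff (x + ℕ→ℚ (pp m i ℕ.∸ k)) (2 ℕ.* (pp m i ℕ.∸ k) ℕ.+ 1)
  * ff (y + ℕ→ℚ (m ℕ.+ i)) k
  * ff (y + ℕ→ℚ k - ℕ→ℚ (m ℕ.+ i ℕ.+ 1)) k

-- On the line y = -x - m the k-th summand of f̃ is 2ᵐ m! (x+2m+i)_{3m+2i+1} times a summand of
--   S_m(x) = Σₙ (-1)ⁿ C(m,n) (x-m-i-1)ₙ (x-i)^(m-n) / ((2i+2n+1)(2i+2n+3)⋯(2i+2n+2m+1)),
-- once each coefficient c_{m,i,k} is evaluated as a beta integral (a^(r) is the rising factorial).
-- Zeilberger's algorithm gives the recurrence (4m+2i+3)(4m+2i+5) S_{m+1} = 4(2m+1)(x+m+½) S_m,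
-- certified by a telescoping identity, so S_m is a constant multiple of (x+m-½)_m. The y-forms
-- follow from the reflection (-a)_k = (-1)^k (a+k-1)_k, and part (b) follows from part (a) since
-- f̃(-x,-y) = -f̃(x,y): the x-factor of each summand is odd and reflection swaps its y-factors.

module Submission where

open import Agda.Builtin.FromNat using (Number; fromNat)
open import Algebra.Bundles.Raw using (RawRing)
open import Data.Integer as ℤ using (+_)
import Data.Integer.Properties as ℤ
open import Data.Nat as ℕ using (ℕ; zero; suc; _∸_; _≤_; _<_; z≤n; s≤s)
open import Data.Nat.Combinatorics using (_C_; nCk+nC[k+1]≡[n+1]C[k+1]; nC1≡n; nCn≡1; k>n⇒nCk≡0)
import Data.Nat.Coprimality as Coprime
import Data.Nat.Literals as ℕ-Literals
import Data.Nat.Properties as ℕ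
open import Data.Nat.Tactic.RingSolver using () renaming (solve-∀ to ℕ-solve-∀)
open import Data.Product using (_×_; ∃; _,_)
open import Data.Rational using (ℚ; mkℚ; _/_; ½; 0ℚ; 1ℚ)
import Data.Rational.Literals as ℚ-Literals
open import Data.Sum using (inj₁; inj₂; [_,_]′)
open import Data.Unit using (⊤; tt)
open import Function using (id)
open import Level using (0ℓ)
open import Relation.Binary.PropositionalEquality
open import Relation.Nullary.Decidable using (dec⇒maybe)
open import Tactic.RingSolver using (solve-∀)
import Tactic.RingSolver.Core.AlmostCommutativeRing as ACR
import Tactic.RingSolver.NonReflective as NonReflective

open import Defs

instance
  ℕ-number : Number ℕ
  ℕ-number = ℕ-Literals.number

  ℚ-number : Number ℚ
  ℚ-number = ℚ-Literals.number

  number-constraint : ⊤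
  number-constraint = tt

-- The recurrence and certificate polynomials are written once over an arbitrary raw ring, so
-- that the same definitions are evaluated in ℚ and handed to the ring solver as syntax.
module WZPolynomials (R : RawRing 0ℓ 0ℓ) (κ : ℚ → RawRing.Carrier R) where
  open RawRing R

  infixl 6 _-_
  _-_ : Carrier → Carrier → Carrier
  a - b = a + - b

  recN : Carrier → Carrier → Carrier
  recN I M = (κ 4 * M + κ 2 * I + κ 3) * (κ 4 * M + κ 2 * I + κ 5)

  recP : Carrier → Carrier → Carrier
  recP x M = κ 4 * (κ 2 * M + κ 1) * (x + M + κ ½)

  certL : Carrier → Carrier → Carrier → Carrier → Carrier
  certL x I M ν = (κ 1 - κ 2 * I - κ 4 * ν) * x
                + (κ 8 * M * M + (κ 6 * I + κ 13) * M + κ 2 * I * I + κ 5 * I + κ 5)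
                + (κ 2 * I + κ 1) * ν

  -- In the telescoping step at index 1 + n the four terms share a common factor; these are the
  -- cofactors, and the step reduces to c₀ α + c₁ β = 0 with c₀ = C(m,n), c₁ = C(m,1+n).
  module _ (x I M n : Carrier) where
    A B C Q₁ Q₂ α β : Carrier
    A  = x - (M + κ 1 + I) - κ 1 - n
    B  = x - I + (M - (n + κ 1))
    C  = x - (M + I) - κ 1
    Q₁ = κ 2 * I + κ 2 * (n + κ 1) + κ 2 * (M + κ 1) + κ 1
    Q₂ = κ 2 * I + κ 2 * (n + κ 1) + κ 1
    α  = - recN I M * A * B - Q₁ * B * certL x I M (n + κ 1)
    β  = - recN I M * A * B + recP x M * Q₁ * C - Q₂ * A * certL x I M (n + κ 2)

open import Data.Rational using (_+_; _*_; _-_; -_)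
open import Data.Rational.Properties

ℚ-ring : ACR.AlmostCommutativeRing 0ℓ 0ℓ
ℚ-ring = ACR.fromCommutativeRing +-*-commutativeRing (λ q → dec⇒maybe (0ℚ ≟ q))

cong₃ : ∀ {X Y Z W : Set} (f : X → Y → Z → W) {x x′ y y′ z z′} → x ≡ x′ → y ≡ y′ → z ≡ z′ → f x y z ≡ f x′ y′ z′
cong₃ f refl refl refl = refl

ℕ→ℚ≡mkℚ : ∀ n → ℕ→ℚ n ≡ mkℚ (+ n) 0 (Coprime.sym (Coprime.1-coprimeTo n))
ℕ→ℚ≡mkℚ n = normalize-coprime (Coprime.sym (Coprime.1-coprimeTo n))

ℕ→ℚ-homo-+ : ∀ m n → ℕ→ℚ (m ℕ.+ n) ≡ ℕ→ℚ m + ℕ→ℚ n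
ℕ→ℚ-homo-+ m n rewrite ℕ→ℚ≡mkℚ m | ℕ→ℚ≡mkℚ n =
  /-cong (trans (ℤ.pos-+ m n) (sym (cong₂ ℤ._+_ (ℤ.*-identityʳ (+ m)) (ℤ.*-identityʳ (+ n))))) refl

ℕ→ℚ-homo-* : ∀ m n → ℕ→ℚ (m ℕ.* n) ≡ ℕ→ℚ m * ℕ→ℚ n
ℕ→ℚ-homo-* m n rewrite ℕ→ℚ≡mkℚ m | ℕ→ℚ≡mkℚ n = /-cong (ℤ.pos-* m n) refl

ℕ→ℚ-suc : ∀ n → ℕ→ℚ (suc n) ≡ ℕ→ℚ n + 1
ℕ→ℚ-suc n = trans (ℕ→ℚ-homo-+ 1 n) (+-comm 1 (ℕ→ℚ n))

ℕ→ℚ-homo-∸ : ∀ {m n} → n ≤ m → ℕ→ℚ (m ∸ n) ≡ ℕ→ℚ m - ℕ→ℚ n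
ℕ→ℚ-homo-∸ {m} {n} n≤m = begin
  ℕ→ℚ (m ∸ n)                    ≡⟨ add-sub (ℕ→ℚ n) (ℕ→ℚ (m ∸ n)) ⟩
  ℕ→ℚ n + ℕ→ℚ (m ∸ n) - ℕ→ℚ n    ≡⟨ cong (_- ℕ→ℚ n) (ℕ→ℚ-homo-+ n (m ∸ n)) ⟨
  ℕ→ℚ (n ℕ.+ (m ∸ n)) - ℕ→ℚ n    ≡⟨ cong (λ k → ℕ→ℚ k - ℕ→ℚ n) (ℕ.m+[n∸m]≡n n≤m) ⟩
  ℕ→ℚ m - ℕ→ℚ n                  ∎
  where
  open ≡-Reasoning
  add-sub : ∀ a b → b ≡ a + b - a
  add-sub = solve-∀ ℚ-ring

-- Polynomial expressions over ℕ, so that a single lemma pushes ℕ→ℚ through any of them.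
infixl 6 _‵+_
infixl 7 _‵*_

data ℕExpr : Set where
  ‵_        : ℕ → ℕExpr
  _‵+_ _‵*_ : ℕExpr → ℕExpr → ℕExpr

⟦_⟧ℕ : ℕExpr → ℕ
⟦ ‵ n    ⟧ℕ = n
⟦ e ‵+ f ⟧ℕ = ⟦ e ⟧ℕ ℕ.+ ⟦ f ⟧ℕ
⟦ e ‵* f ⟧ℕ = ⟦ e ⟧ℕ ℕ.* ⟦ f ⟧ℕ

⟦_⟧ℚ : ℕExpr → ℚ
⟦ ‵ n    ⟧ℚ = ℕ→ℚ n
⟦ e ‵+ f ⟧ℚ = ⟦ e ⟧ℚ + ⟦ f ⟧ℚ
⟦ e ‵* f ⟧ℚ = ⟦ e ⟧ℚ * ⟦ f ⟧ℚ

ℕ→ℚ-homo : ∀ e → ℕ→ℚ ⟦ e ⟧ℕ ≡ ⟦ e ⟧ℚ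
ℕ→ℚ-homo (‵ n)    = refl
ℕ→ℚ-homo (e ‵+ f) = trans (ℕ→ℚ-homo-+ ⟦ e ⟧ℕ ⟦ f ⟧ℕ) (cong₂ _+_ (ℕ→ℚ-homo e) (ℕ→ℚ-homo f))
ℕ→ℚ-homo (e ‵* f) = trans (ℕ→ℚ-homo-* ⟦ e ⟧ℕ ⟦ f ⟧ℕ) (cong₂ _*_ (ℕ→ℚ-homo e) (ℕ→ℚ-homo f))

-- recip 0 = 0 is a junk value; on suc n this is definitionally the (+ 1) / suc n of coef.
recip : ℕ → ℚ
recip zero    = 0ℚ
recip (suc n) = + 1 / suc n

recip-inverseˡ : ∀ n → recip (suc n) * ℕ→ℚ (suc n) ≡ 1ℚ
recip-inverseˡ n =
  trans (cong₂ _*_ (normalize-coprime (Coprime.1-coprimeTo (suc n))) (ℕ→ℚ≡mkℚ (suc n)))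
        (*-inverseˡ (mkℚ (+ suc n) 0 (Coprime.sym (Coprime.1-coprimeTo (suc n)))))

inverse-unique-* : ∀ {r a b} {ra rb} → ra * a ≡ 1ℚ → rb * b ≡ 1ℚ → r * (a * b) ≡ 1ℚ → r ≡ ra * rb
inverse-unique-* {r} {a} {b} {ra} {rb} ra*a≡1 rb*b≡1 r*ab≡1 = begin
  r                               ≡⟨ *-identityʳ r ⟨
  r * 1ℚ                          ≡⟨ cong (λ t → r * t) (cong₂ _*_ ra*a≡1 rb*b≡1) ⟨
  r * ((ra * a) * (rb * b))       ≡⟨ regroup r a b ra rb ⟩
  (r * (a * b)) * (ra * rb)       ≡⟨ cong (_* (ra * rb)) r*ab≡1 ⟩
  1ℚ * (ra * rb)                  ≡⟨ *-identityˡ (ra * rb) ⟩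
  ra * rb                         ∎
  where
  open ≡-Reasoning
  regroup : ∀ r a b ra rb → r * ((ra * a) * (rb * b)) ≡ (r * (a * b)) * (ra * rb)
  regroup = solve-∀ ℚ-ring

recip-homo-* : ∀ m n → recip (m ℕ.* n) ≡ recip m * recip n
recip-homo-* zero    n       = sym (*-zeroˡ (recip n))
recip-homo-* (suc m) zero    rewrite ℕ.*-zeroʳ m = sym (*-zeroʳ (recip (suc m)))
recip-homo-* (suc m) (suc n) =
  inverse-unique-* {a = ℕ→ℚ (suc m)} {b = ℕ→ℚ (suc n)} {recip (suc m)} {recip (suc n)} (recip-inverseˡ m) (recip-inverseˡ n)
  (trans (cong (recip (suc m ℕ.* suc n) *_) (sym (ℕ→ℚ-homo-* (suc m) (suc n))))
         (recip-inverseˡ (n ℕ.+ m ℕ.* suc n)))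

recip-factorʳ : ∀ d c → recip d ≡ recip (d ℕ.* suc c) * ℕ→ℚ (suc c)
recip-factorʳ d c = begin
  recip d                                     ≡⟨ *-identityʳ (recip d) ⟨
  recip d * 1ℚ                                ≡⟨ cong (recip d *_) (recip-inverseˡ c) ⟨
  recip d * (recip (suc c) * ℕ→ℚ (suc c))     ≡⟨ *-assoc (recip d) (recip (suc c)) (ℕ→ℚ (suc c)) ⟨
  recip d * recip (suc c) * ℕ→ℚ (suc c)       ≡⟨ cong (_* ℕ→ℚ (suc c)) (recip-homo-* d (suc c)) ⟨
  recip (d ℕ.* suc c) * ℕ→ℚ (suc c)           ∎
  where open ≡-Reasoning

recip-factorˡ : ∀ c d → recip d ≡ recip (suc c ℕ.* d) * ℕ→ℚ (suc c)
recip-factorˡ c d = trans (recip-factorʳ d c) (cong (λ t → recip t * ℕ→ℚ (suc c)) (ℕ.*-comm d (suc c)))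

sumTo-cong : ∀ n {f g : ℕ → ℚ} → (∀ k → k ≤ n → f k ≡ g k) → sumTo n f ≡ sumTo n g
sumTo-cong zero    f≗g = f≗g 0 z≤n
sumTo-cong (suc n) f≗g =
  cong₂ _+_ (sumTo-cong n (λ k k≤n → f≗g k (ℕ.m≤n⇒m≤1+n k≤n))) (f≗g (suc n) ℕ.≤-refl)

sumTo-*ˡ : ∀ n c (f : ℕ → ℚ) → sumTo n (λ k → c * f k) ≡ c * sumTo n f
sumTo-*ˡ zero    c f = refl
sumTo-*ˡ (suc n) c f = trans (cong (_+ c * f (suc n)) (sumTo-*ˡ n c f)) (sym (*-distribˡ-+ c (sumTo n f) (f (suc n))))

sumTo-neg : ∀ n (f : ℕ → ℚ) → sumTo n (λ k → - f k) ≡ - sumTo n f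
sumTo-neg zero    f = refl
sumTo-neg (suc n) f = trans (cong (_+ - f (suc n)) (sumTo-neg n f)) (sym (neg-distrib-+ (sumTo n f) (f (suc n))))

sumTo-sub : ∀ n (f g : ℕ → ℚ) → sumTo n (λ k → f k - g k) ≡ sumTo n f - sumTo n g
sumTo-sub zero    f g = refl
sumTo-sub (suc n) f g = trans (cong (_+ (f (suc n) - g (suc n))) (sumTo-sub n f g))
                              (interchange (sumTo n f) (sumTo n g) (f (suc n)) (g (suc n)))
  where
  interchange : ∀ a b c d → a - b + (c - d) ≡ a + c - (b + d)
  interchange = solve-∀ ℚ-ring

sumTo-unfoldˡ : ∀ n (f : ℕ → ℚ) → sumTo (suc n) f ≡ f 0 + sumTo n (λ k → f (suc k))
sumTo-unfoldˡ zero    f = refl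
sumTo-unfoldˡ (suc n) f = trans (cong (_+ f (suc (suc n))) (sumTo-unfoldˡ n f))
                                (+-assoc (f 0) (sumTo n (λ k → f (suc k))) (f (suc (suc n))))

sumTo-reverse : ∀ n (f : ℕ → ℚ) → sumTo n f ≡ sumTo n (λ k → f (n ∸ k))
sumTo-reverse zero    f = refl
sumTo-reverse (suc n) f = begin
  sumTo (suc n) f                                ≡⟨ sumTo-unfoldˡ n f ⟩
  f 0 + sumTo n (λ k → f (suc k))                ≡⟨ cong (λ t → f 0 + t) (sumTo-reverse n (λ k → f (suc k))) ⟩
  f 0 + sumTo n (λ k → f (suc (n ∸ k)))          ≡⟨ +-comm (f 0) _ ⟩
  sumTo n (λ k → f (suc (n ∸ k))) + f 0          ≡⟨ cong₂ _+_ (sumTo-cong n (λ k k≤n → cong f (sym (ℕ.+-∸-assoc 1 k≤n))))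
                                                              (cong f (sym (ℕ.n∸n≡0 n))) ⟩
  sumTo (suc n) (λ k → f (suc n ∸ k))            ∎
  where open ≡-Reasoning

sumTo-telescope : ∀ n (f g : ℕ → ℚ) → (∀ k → k ≤ n → f k ≡ g (suc k) - g k) → sumTo n f ≡ g (suc n) - g 0
sumTo-telescope zero    f g f≡Δg = f≡Δg 0 z≤n
sumTo-telescope (suc n) f g f≡Δg = begin
  sumTo n f + f (suc n)                           ≡⟨ cong₂ _+_ (sumTo-telescope n f g (λ k k≤n → f≡Δg k (ℕ.m≤n⇒m≤1+n k≤n)))
                                                              (f≡Δg (suc n) ℕ.≤-refl) ⟩
  g (suc n) - g 0 + (g (suc (suc n)) - g (suc n)) ≡⟨ collapse (g 0) (g (suc n)) (g (suc (suc n))) ⟩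
  g (suc (suc n)) - g 0                           ∎
  where
  open ≡-Reasoning
  collapse : ∀ a b c → b - a + (c - b) ≡ c - a
  collapse = solve-∀ ℚ-ring

sgn-homo-+ : ∀ m n → sgn (m ℕ.+ n) ≡ sgn m * sgn n
sgn-homo-+ zero    n = sym (*-identityˡ (sgn n))
sgn-homo-+ (suc m) n = trans (cong -_ (sgn-homo-+ m n)) (neg-distribˡ-* (sgn m) (sgn n))

sgn-square : ∀ n → sgn n * sgn n ≡ 1ℚ
sgn-square zero    = refl
sgn-square (suc n) = trans (neg-square (sgn n)) (sgn-square n)
  where
  neg-square : ∀ a → - a * - a ≡ a * a
  neg-square = solve-∀ ℚ-ring

sgn-odd : ∀ n → sgn (2 ℕ.* n ℕ.+ 1) ≡ - 1ℚ
sgn-odd n = begin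
  sgn (2 ℕ.* n ℕ.+ 1)          ≡⟨ sgn-homo-+ (2 ℕ.* n) 1 ⟩
  sgn (n ℕ.+ (n ℕ.+ 0)) * - 1ℚ ≡⟨ cong (λ k → sgn (n ℕ.+ k) * - 1ℚ) (ℕ.+-identityʳ n) ⟩
  sgn (n ℕ.+ n) * - 1ℚ         ≡⟨ cong (_* - 1ℚ) (trans (sgn-homo-+ n n) (sgn-square n)) ⟩
  1ℚ * - 1ℚ                    ≡⟨⟩
  - 1ℚ                         ∎
  where open ≡-Reasoning

-- Falling and rising factorials

rf : ℚ → ℕ → ℚ
rf a zero    = 1ℚ
rf a (suc k) = rf a k * (a + ℕ→ℚ k)

ff-sucˡ : ∀ a k → ff a (suc k) ≡ a * ff (a - 1ℚ) k
ff-sucˡ a zero    = trans (*-identityˡ (a - 0ℚ)) (trans (+-identityʳ a) (sym (*-identityʳ a)))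
ff-sucˡ a (suc k) = begin
  ff a (suc k) * (a - ℕ→ℚ (suc k))                ≡⟨ cong₂ (λ u v → u * (a - v)) (ff-sucˡ a k) (ℕ→ℚ-suc k) ⟩
  a * ff (a - 1ℚ) k * (a - (ℕ→ℚ k + 1ℚ))         ≡⟨ regroup a (ff (a - 1ℚ) k) (ℕ→ℚ k) ⟩
  a * (ff (a - 1ℚ) k * (a - 1ℚ - ℕ→ℚ k))         ∎
  where
  open ≡-Reasoning
  regroup : ∀ a F K → a * F * (a - (K + 1)) ≡ a * (F * (a - 1 - K))
  regroup = solve-∀ ℚ-ring

ff-+ : ∀ a s t → ff a (s ℕ.+ t) ≡ ff a s * ff (a - ℕ→ℚ s) t
ff-+ a s zero    = trans (cong (ff a) (ℕ.+-identityʳ s)) (sym (*-identityʳ (ff a s)))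
ff-+ a s (suc t) = begin
  ff a (s ℕ.+ suc t)                                        ≡⟨ cong (ff a) (ℕ.+-suc s t) ⟩
  ff a (s ℕ.+ t) * (a - ℕ→ℚ (s ℕ.+ t))                      ≡⟨ cong₂ (λ u v → u * (a - v)) (ff-+ a s t) (ℕ→ℚ-homo-+ s t) ⟩
  ff a s * ff (a - ℕ→ℚ s) t * (a - (ℕ→ℚ s + ℕ→ℚ t))        ≡⟨ regroup (ff a s) (ff (a - ℕ→ℚ s) t) a (ℕ→ℚ s) (ℕ→ℚ t) ⟩
  ff a s * (ff (a - ℕ→ℚ s) t * (a - ℕ→ℚ s - ℕ→ℚ t))        ∎
  where
  open ≡-Reasoning
  regroup : ∀ F G a S T → F * G * (a - (S + T)) ≡ F * (G * (a - S - T))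
  regroup = solve-∀ ℚ-ring

ff-neg : ∀ a k → ff (- a) k ≡ sgn k * rf a k
ff-neg a zero    = refl
ff-neg a (suc k) = trans (cong (_* (- a - ℕ→ℚ k)) (ff-neg a k)) (regroup (sgn k) (rf a k) a (ℕ→ℚ k))
  where
  regroup : ∀ s R a K → s * R * (- a - K) ≡ - s * (R * (a + K))
  regroup = solve-∀ ℚ-ring

rf≡ff : ∀ a k → rf a k ≡ ff (a + ℕ→ℚ k - 1ℚ) k
rf≡ff a zero    = refl
rf≡ff a (suc k) = begin
  rf a k * (a + ℕ→ℚ k)                                ≡⟨ cong (_* (a + ℕ→ℚ k)) (rf≡ff a k) ⟩
  ff (a + ℕ→ℚ k - 1ℚ) k * (a + ℕ→ℚ k)                 ≡⟨ *-comm (ff (a + ℕ→ℚ k - 1ℚ) k) (a + ℕ→ℚ k) ⟩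
  (a + ℕ→ℚ k) * ff (a + ℕ→ℚ k - 1ℚ) k                 ≡⟨ cong₂ (λ u v → u * ff v k) (top a (ℕ→ℚ k)) (next a (ℕ→ℚ k)) ⟩
  b * ff (b - 1ℚ) k                                   ≡⟨ ff-sucˡ b k ⟨
  ff b (suc k)                                        ≡⟨ cong (λ t → ff (a + t - 1ℚ) (suc k)) (ℕ→ℚ-suc k) ⟨
  ff (a + ℕ→ℚ (suc k) - 1ℚ) (suc k)                   ∎
  where
  open ≡-Reasoning
  b = a + (ℕ→ℚ k + 1ℚ) - 1ℚ
  top : ∀ a K → a + K ≡ a + (K + 1) - 1
  top = solve-∀ ℚ-ring
  next : ∀ a K → a + K - 1 ≡ a + (K + 1) - 1 - 1
  next = solve-∀ ℚ-ring

ff-reflect : ∀ {a b} c k → a ≡ - c → c + ℕ→ℚ k - 1ℚ ≡ b → ff a k ≡ sgn k * ff b k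
ff-reflect c k refl refl = trans (ff-neg c k) (cong (sgn k *_) (rf≡ff c k))

ff-odd : ∀ c x → ff (- x + ℕ→ℚ c) (2 ℕ.* c ℕ.+ 1) ≡ - ff (x + ℕ→ℚ c) (2 ℕ.* c ℕ.+ 1)
ff-odd c x = begin
  ff (- x + ℕ→ℚ c) (2 ℕ.* c ℕ.+ 1)                       ≡⟨ ff-reflect (x - ℕ→ℚ c) (2 ℕ.* c ℕ.+ 1) (flip x (ℕ→ℚ c)) reflected ⟩
  sgn (2 ℕ.* c ℕ.+ 1) * ff (x + ℕ→ℚ c) (2 ℕ.* c ℕ.+ 1)   ≡⟨ cong (_* ff (x + ℕ→ℚ c) (2 ℕ.* c ℕ.+ 1)) (sgn-odd c) ⟩
  - 1ℚ * ff (x + ℕ→ℚ c) (2 ℕ.* c ℕ.+ 1)                  ≡⟨ minus-one _ ⟩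
  - ff (x + ℕ→ℚ c) (2 ℕ.* c ℕ.+ 1)                       ∎
  where
  open ≡-Reasoning
  flip : ∀ x c → - x + c ≡ - (x - c)
  flip = solve-∀ ℚ-ring
  minus-one : ∀ a → - 1 * a ≡ - a
  minus-one = solve-∀ ℚ-ring
  reflected : x - ℕ→ℚ c + ℕ→ℚ (2 ℕ.* c ℕ.+ 1) - 1ℚ ≡ x + ℕ→ℚ c
  reflected = trans (cong (λ t → x - ℕ→ℚ c + t - 1ℚ) (ℕ→ℚ-homo (‵ 2 ‵* ‵ c ‵+ ‵ 1))) (simplify x (ℕ→ℚ c))
    where
    simplify : ∀ x c → x - c + (2 * c + 1) - 1 ≡ x + c
    simplify = solve-∀ ℚ-ring

ff-pair-even : ∀ {a b} k y → b ≡ a + 1ℚ →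
  ff (- y + a) k * ff (- y + ℕ→ℚ k - b) k ≡ ff (y + a) k * ff (y + ℕ→ℚ k - b) k
ff-pair-even {a} k y refl = begin
  ff (- y + a) k * ff (- y + K - (a + 1ℚ)) k                      ≡⟨ cong₂ _*_ (ff-reflect (y - a) k (flip₁ y a) (shift₁ y a K))
                                                                               (ff-reflect (y - K + (a + 1ℚ)) k (flip₂ y a K) (shift₂ y a K)) ⟩
  sgn k * ff (y + K - (a + 1ℚ)) k * (sgn k * ff (y + a) k)        ≡⟨ regroup (sgn k) (ff (y + K - (a + 1ℚ)) k) (ff (y + a) k) ⟩
  sgn k * sgn k * (ff (y + a) k * ff (y + K - (a + 1ℚ)) k)        ≡⟨ cong (_* (ff (y + a) k * ff (y + K - (a + 1ℚ)) k)) (sgn-square k) ⟩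
  1ℚ * (ff (y + a) k * ff (y + K - (a + 1ℚ)) k)                   ≡⟨ *-identityˡ _ ⟩
  ff (y + a) k * ff (y + K - (a + 1ℚ)) k                          ∎
  where
  open ≡-Reasoning
  K : ℚ
  K = ℕ→ℚ k
  flip₁ : ∀ y a → - y + a ≡ - (y - a)
  flip₁ = solve-∀ ℚ-ring
  shift₁ : ∀ y a K → y - a + K - 1 ≡ y + K - (a + 1)
  shift₁ = solve-∀ ℚ-ring
  flip₂ : ∀ y a K → - y + K - (a + 1) ≡ - (y - K + (a + 1))
  flip₂ = solve-∀ ℚ-ring
  shift₂ : ∀ y a K → y - K + (a + 1) + K - 1 ≡ y + a
  shift₂ = solve-∀ ℚ-ring
  regroup : ∀ s F G → s * F * (s * G) ≡ s * s * (G * F)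
  regroup = solve-∀ ℚ-ring

ff-reflect-pair : ∀ L n {a b a′ b′} c d → sgn L * sgn n ≡ - 1ℚ →
  a ≡ - c → c + ℕ→ℚ L - 1ℚ ≡ a′ → b ≡ - d → d + ℕ→ℚ n - 1ℚ ≡ b′ → ff a L * ff b n ≡ - (ff a′ L * ff b′ n)
ff-reflect-pair L n {a′ = a′} {b′ = b′} c d odd a≡-c c≡a′ b≡-d d≡b′ = begin
  ff _ L * ff _ n                       ≡⟨ cong₂ _*_ (ff-reflect c L a≡-c c≡a′) (ff-reflect d n b≡-d d≡b′) ⟩
  sgn L * ff a′ L * (sgn n * ff b′ n)   ≡⟨ regroup (sgn L) (sgn n) (ff a′ L) (ff b′ n) ⟩
  sgn L * sgn n * (ff a′ L * ff b′ n)   ≡⟨ cong (_* (ff a′ L * ff b′ n)) odd ⟩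
  - 1ℚ * (ff a′ L * ff b′ n)            ≡⟨ minus-one (ff a′ L * ff b′ n) ⟩
  - (ff a′ L * ff b′ n)                 ∎
  where
  open ≡-Reasoning
  regroup : ∀ s t F G → s * F * (t * G) ≡ s * t * (F * G)
  regroup = solve-∀ ℚ-ring
  minus-one : ∀ a → - 1 * a ≡ - a
  minus-one = solve-∀ ℚ-ring

-- Binomial sums

[1+k]*nC[1+k]≡[n∸k]*nCk : ∀ n k → suc k ℕ.* (n C suc k) ≡ (n ∸ k) ℕ.* (n C k)
[1+k]*nC[1+k]≡[n∸k]*nCk zero    k       rewrite k>n⇒nCk≡0 {0} {suc k} (s≤s z≤n) | ℕ.0∸n≡0 k = ℕ.*-zeroʳ k
[1+k]*nC[1+k]≡[n∸k]*nCk (suc n) zero    = trans (ℕ.+-identityʳ (suc n C 1)) (trans (nC1≡n (suc n)) (sym (ℕ.*-identityʳ (suc n))))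
[1+k]*nC[1+k]≡[n∸k]*nCk (suc n) (suc k) with ℕ.<-≤-connex k n
... | inj₂ n≤k rewrite k>n⇒nCk≡0 {suc n} {suc (suc k)} (s≤s (s≤s n≤k)) | ℕ.m≤n⇒m∸n≡0 n≤k = ℕ.*-zeroʳ (suc (suc k))
... | inj₁ k<n = begin
  suc (suc k) ℕ.* (suc n C suc (suc k))             ≡⟨ cong (suc (suc k) ℕ.*_) (nCk+nC[k+1]≡[n+1]C[k+1] n (suc k)) ⟨
  suc (suc k) ℕ.* (c₁ ℕ.+ c₂)                       ≡⟨ split k c₁ c₂ ⟩
  suc k ℕ.* c₁ ℕ.+ c₁ ℕ.+ suc (suc k) ℕ.* c₂        ≡⟨ cong₂ (λ a b → a ℕ.+ c₁ ℕ.+ b) ([1+k]*nC[1+k]≡[n∸k]*nCk n k)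
                                                                                  ([1+k]*nC[1+k]≡[n∸k]*nCk n (suc k)) ⟩
  (n ∸ k) ℕ.* c₀ ℕ.+ c₁ ℕ.+ (n ∸ suc k) ℕ.* c₁      ≡⟨ cong (λ t → t ℕ.* c₀ ℕ.+ c₁ ℕ.+ (n ∸ suc k) ℕ.* c₁) n∸k≡1+r ⟩
  suc r ℕ.* c₀ ℕ.+ c₁ ℕ.+ r ℕ.* c₁                  ≡⟨ merge r c₀ c₁ ⟩
  suc r ℕ.* (c₀ ℕ.+ c₁)                             ≡⟨ cong₂ ℕ._*_ (sym n∸k≡1+r) (nCk+nC[k+1]≡[n+1]C[k+1] n k) ⟩
  (n ∸ k) ℕ.* (suc n C suc k)                       ∎
  where
  open ≡-Reasoning
  c₀ c₁ c₂ r : ℕ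
  c₀ = n C k
  c₁ = n C suc k
  c₂ = n C suc (suc k)
  r  = n ∸ suc k
  n∸k≡1+r : n ∸ k ≡ suc r
  n∸k≡1+r = ℕ.+-∸-assoc 1 k<n
  split : ∀ k a b → suc (suc k) ℕ.* (a ℕ.+ b) ≡ suc k ℕ.* a ℕ.+ a ℕ.+ suc (suc k) ℕ.* b
  split = ℕ-solve-∀
  merge : ∀ r a b → suc r ℕ.* a ℕ.+ b ℕ.+ r ℕ.* b ≡ suc r ℕ.* (a ℕ.+ b)
  merge = ℕ-solve-∀

prod₂ : ℕ → ℕ → ℕ
prod₂ s zero    = s
prod₂ s (suc m) = prod₂ s m ℕ.* (s ℕ.+ 2 ℕ.* suc m)

prod₂-sucˡ : ∀ s m → prod₂ s (suc m) ≡ s ℕ.* prod₂ (2 ℕ.+ s) m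
prod₂-sucˡ s zero    = ℕ-solve-∀-lemma s
  where
  ℕ-solve-∀-lemma : ∀ s → s ℕ.* (s ℕ.+ 2 ℕ.* 1) ≡ s ℕ.* (2 ℕ.+ s)
  ℕ-solve-∀-lemma = ℕ-solve-∀
prod₂-sucˡ s (suc m) = trans (cong (ℕ._* (s ℕ.+ 2 ℕ.* suc (suc m))) (prod₂-sucˡ s m)) (regroup s (prod₂ (2 ℕ.+ s) m) m)
  where
  regroup : ∀ s P m → s ℕ.* P ℕ.* (s ℕ.+ 2 ℕ.* suc (suc m)) ≡ s ℕ.* (P ℕ.* (2 ℕ.+ s ℕ.+ 2 ℕ.* suc m))
  regroup = ℕ-solve-∀

evenFactorial : ℕ → ℚ
evenFactorial zero    = 1ℚ
evenFactorial (suc m) = evenFactorial m * (2 * ℕ→ℚ (suc m))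

alternating-binomial-sum-suc : ∀ m (f : ℕ → ℚ) →
  sumTo (suc m) (λ a → sgn a * ℕ→ℚ (suc m C a) * f a)
    ≡ sumTo m (λ a → sgn a * ℕ→ℚ (m C a) * f a) - sumTo m (λ a → sgn a * ℕ→ℚ (m C a) * f (suc a))
alternating-binomial-sum-suc m f = begin
  sumTo (suc m) g                                  ≡⟨ sumTo-unfoldˡ m g ⟩
  g 0 + sumTo m (λ a → g (suc a))                  ≡⟨ cong (λ t → g 0 + t) (trans (sumTo-cong m (λ a _ → pascal a))
                                                                                   (sumTo-sub m (λ a → h (suc a)) h′)) ⟩
  h 0 + (sumTo m (λ a → h (suc a)) - sumTo m h′)   ≡⟨ +-assoc (h 0) _ _ ⟨
  h 0 + sumTo m (λ a → h (suc a)) - sumTo m h′     ≡⟨ cong (_- sumTo m h′) (sumTo-unfoldˡ m h) ⟨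
  sumTo m h + h (suc m) - sumTo m h′               ≡⟨ cong (λ t → sumTo m h + t - sumTo m h′) h-top ⟩
  sumTo m h + 0ℚ - sumTo m h′                      ≡⟨ cong (_- sumTo m h′) (+-identityʳ (sumTo m h)) ⟩
  sumTo m h - sumTo m h′                           ∎
  where
  open ≡-Reasoning
  g h h′ : ℕ → ℚ
  g a  = sgn a * ℕ→ℚ (suc m C a) * f a
  h a  = sgn a * ℕ→ℚ (m C a) * f a
  h′ a = sgn a * ℕ→ℚ (m C a) * f (suc a)
  distribute : ∀ s c₀ c₁ F → - s * (c₀ + c₁) * F ≡ - s * c₁ * F - s * c₀ * F
  distribute = solve-∀ ℚ-ring
  pascal : ∀ a → g (suc a) ≡ h (suc a) - h′ a
  pascal a = trans (cong (λ c → - sgn a * c * f (suc a))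
                         (trans (cong ℕ→ℚ (sym (nCk+nC[k+1]≡[n+1]C[k+1] m a))) (ℕ→ℚ-homo-+ (m C a) (m C suc a))))
                   (distribute (sgn a) (ℕ→ℚ (m C a)) (ℕ→ℚ (m C suc a)) (f (suc a)))
  h-top : h (suc m) ≡ 0ℚ
  h-top rewrite k>n⇒nCk≡0 {m} {suc m} ℕ.≤-refl = trans (cong (_* f (suc m)) (*-zeroʳ (sgn (suc m)))) (*-zeroˡ (f (suc m)))

-- Both sides equal ∫₀¹ tˢ (1 - t²)ᵐ dt.
alternating-binomial-reciprocal : ∀ m s →
  sumTo m (λ a → sgn a * ℕ→ℚ (m C a) * recip (suc s ℕ.+ 2 ℕ.* a)) ≡ evenFactorial m * recip (prod₂ (suc s) m)
alternating-binomial-reciprocal zero    s = cong (λ t → 1ℚ * 1ℚ * recip t) (ℕ.+-identityʳ (suc s))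
alternating-binomial-reciprocal (suc m) s = begin
  sumTo (suc m) (λ a → sgn a * ℕ→ℚ (suc m C a) * f a)
    ≡⟨ alternating-binomial-sum-suc m f ⟩
  sumTo m (λ a → sgn a * ℕ→ℚ (m C a) * f a) - sumTo m (λ a → sgn a * ℕ→ℚ (m C a) * f (suc a))
    ≡⟨ cong₂ _-_ (alternating-binomial-reciprocal m s)
                 (trans (sumTo-cong m (λ a _ → cong (λ t → sgn a * ℕ→ℚ (m C a) * recip t) (shift s a)))
                        (alternating-binomial-reciprocal m (2 ℕ.+ s))) ⟩
  evenFactorial m * recip (prod₂ (suc s) m) - evenFactorial m * recip (prod₂ (2 ℕ.+ suc s) m)
    ≡⟨ cong₂ (λ u v → evenFactorial m * u - evenFactorial m * v) (recip-factorʳ (prod₂ (suc s) m) _) first ⟩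
  evenFactorial m * (E * ℕ→ℚ (suc s ℕ.+ 2 ℕ.* suc m)) - evenFactorial m * (E * ℕ→ℚ (suc s))
    ≡⟨ cong (λ t → evenFactorial m * (E * t) - evenFactorial m * (E * ℕ→ℚ (suc s)))
            (ℕ→ℚ-homo (‵ suc s ‵+ ‵ 2 ‵* ‵ suc m)) ⟩
  evenFactorial m * (E * (ℕ→ℚ (suc s) + 2 * ℕ→ℚ (suc m))) - evenFactorial m * (E * ℕ→ℚ (suc s))
    ≡⟨ difference (evenFactorial m) E (ℕ→ℚ (suc s)) (ℕ→ℚ (suc m)) ⟩
  evenFactorial (suc m) * E ∎
  where
  open ≡-Reasoning
  f : ℕ → ℚ
  f a = recip (suc s ℕ.+ 2 ℕ.* a)
  E : ℚ
  E = recip (prod₂ (suc s) (suc m))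
  shift : ∀ s a → suc s ℕ.+ 2 ℕ.* suc a ≡ suc (2 ℕ.+ s) ℕ.+ 2 ℕ.* a
  shift = ℕ-solve-∀
  first : recip (prod₂ (2 ℕ.+ suc s) m) ≡ E * ℕ→ℚ (suc s)
  first = trans (recip-factorˡ s (prod₂ (2 ℕ.+ suc s) m)) (cong (λ t → recip t * ℕ→ℚ (suc s)) (sym (prod₂-sucˡ (suc s) m)))
  difference : ∀ b E S M → b * (E * (S + 2 * M)) - b * (E * S) ≡ b * (2 * M) * E
  difference = solve-∀ ℚ-ring

coef-closed : ∀ m i k → let b = m ∸ k in
  coef m i k ≡ sgn b * ℕ→ℚ (m C b) * (evenFactorial m * recip (prod₂ (suc (2 ℕ.* i ℕ.+ 2 ℕ.* b)) m))
coef-closed m i k = begin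
  coef m i k                                                       ≡⟨ sumTo-cong m (λ a _ → separate a) ⟩
  sumTo m (λ a → c * (sgn a * ℕ→ℚ (m C a) * recip (s ℕ.+ 2 ℕ.* a))) ≡⟨ sumTo-*ˡ m c _ ⟩
  c * sumTo m (λ a → sgn a * ℕ→ℚ (m C a) * recip (s ℕ.+ 2 ℕ.* a))   ≡⟨ cong (c *_) (alternating-binomial-reciprocal m (2 ℕ.* i ℕ.+ 2 ℕ.* b)) ⟩
  c * (evenFactorial m * recip (prod₂ s m))                        ∎
  where
  open ≡-Reasoning
  b s : ℕ
  b = m ∸ k
  s = suc (2 ℕ.* i ℕ.+ 2 ℕ.* b)
  c : ℚ
  c = sgn b * ℕ→ℚ (m C b)
  reorder : ∀ i a b → suc (2 ℕ.* i ℕ.+ 2 ℕ.* a ℕ.+ 2 ℕ.* b) ≡ suc (2 ℕ.* i ℕ.+ 2 ℕ.* b) ℕ.+ 2 ℕ.* a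
  reorder = ℕ-solve-∀
  regroup : ∀ sa sb ca cb r → sa * sb * (ca * cb) * r ≡ sb * cb * (sa * ca * r)
  regroup = solve-∀ ℚ-ring
  separate : ∀ a → sgn (a ℕ.+ b) * ℕ→ℚ ((m C a) ℕ.* (m C b)) * recip (suc (2 ℕ.* i ℕ.+ 2 ℕ.* a ℕ.+ 2 ℕ.* b))
                   ≡ c * (sgn a * ℕ→ℚ (m C a) * recip (s ℕ.+ 2 ℕ.* a))
  separate a = begin
    sgn (a ℕ.+ b) * ℕ→ℚ ((m C a) ℕ.* (m C b)) * recip (suc (2 ℕ.* i ℕ.+ 2 ℕ.* a ℕ.+ 2 ℕ.* b))
      ≡⟨ cong₂ _*_ (cong₂ _*_ (sgn-homo-+ a b) (ℕ→ℚ-homo-* (m C a) (m C b))) (cong recip (reorder i a b)) ⟩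
    sgn a * sgn b * (ℕ→ℚ (m C a) * ℕ→ℚ (m C b)) * recip (s ℕ.+ 2 ℕ.* a)
      ≡⟨ regroup (sgn a) (sgn b) (ℕ→ℚ (m C a)) (ℕ→ℚ (m C b)) _ ⟩
    c * (sgn a * ℕ→ℚ (m C a) * recip (s ℕ.+ 2 ℕ.* a)) ∎

-- The Zeilberger recurrence

open NonReflective ℚ-ring using (solve; Expr; Κ; _⊕_; _⊗_; ⊝_; _⊜_)

ExprRing : ℕ → RawRing 0ℓ 0ℓ
ExprRing n = record
  { Carrier = Expr ℚ n ; _≈_ = _≡_ ; _+_ = _⊕_ ; _*_ = _⊗_ ; -_ = ⊝_ ; 0# = Κ 0ℚ ; 1# = Κ 1ℚ }

module WZ = WZPolynomials +-*-rawRing id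
module WZSyntax n = WZPolynomials (ExprRing n) Κ

wz-interior : ∀ x I M n → (n + 1) * WZ.α x I M n + (M - n) * WZ.β x I M n ≡ 0ℚ
wz-interior = solve 4
  (λ x I M n → (n ⊕ Κ 1) ⊗ WZSyntax.α 4 x I M n ⊕ (M ⊕ ⊝ n) ⊗ WZSyntax.β 4 x I M n ⊜ Κ 0ℚ)
  (λ {_ _ _ _} → refl)

wz-bottom : ∀ x I M →
  WZ.recN I M * (x - I + M) - WZ.recP x M * (2 * I + 2 * (M + 1) + 1) ≡ - (2 * I + 1) * WZ.certL x I M 1
wz-bottom = solve 3
  (λ x I M → WZSyntax.recN 3 I M ⊗ (x ⊕ ⊝ I ⊕ M) ⊕ ⊝ (WZSyntax.recP 3 x M ⊗ (Κ 2 ⊗ I ⊕ Κ 2 ⊗ (M ⊕ Κ 1) ⊕ Κ 1))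
           ⊜ ⊝ (Κ 2 ⊗ I ⊕ Κ 1) ⊗ WZSyntax.certL 3 x I M (Κ 1))
  (λ {_ _ _} → refl)

wz-top : ∀ x I M → WZ.recN I M * WZ.A x I M M ≡ - WZ.Q₁ x I M M * WZ.certL x I M (M + 1)
wz-top = solve 3
  (λ x I M → WZSyntax.recN 3 I M ⊗ WZSyntax.A 3 x I M M ⊜ ⊝ WZSyntax.Q₁ 3 x I M M ⊗ WZSyntax.certL 3 x I M (M ⊕ Κ 1))
  (λ {_ _ _} → refl)

proportional-zero : ∀ {p q c₀ c₁ a b} u → u * p ≡ 1ℚ → p * c₁ ≡ q * c₀ → p * a + q * b ≡ 0ℚ → c₀ * a + c₁ * b ≡ 0ℚ
proportional-zero {p} {q} {c₀} {c₁} {a} {b} u up≡1 pc₁≡qc₀ pa+qb≡0 = begin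
  c₀ * a + c₁ * b                     ≡⟨ *-identityˡ _ ⟨
  1ℚ * (c₀ * a + c₁ * b)              ≡⟨ cong (_* (c₀ * a + c₁ * b)) up≡1 ⟨
  u * p * (c₀ * a + c₁ * b)           ≡⟨ expand u p c₀ c₁ a b ⟩
  u * (c₀ * (p * a) + p * c₁ * b)     ≡⟨ cong (λ t → u * (c₀ * (p * a) + t * b)) pc₁≡qc₀ ⟩
  u * (c₀ * (p * a) + q * c₀ * b)     ≡⟨ factor u p q c₀ a b ⟩
  u * c₀ * (p * a + q * b)            ≡⟨ cong (u * c₀ *_) pa+qb≡0 ⟩
  u * c₀ * 0ℚ                         ≡⟨ *-zeroʳ (u * c₀) ⟩
  0ℚ                                  ∎
  where
  open ≡-Reasoning
  expand : ∀ u p c₀ c₁ a b → u * p * (c₀ * a + c₁ * b) ≡ u * (c₀ * (p * a) + p * c₁ * b)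
  expand = solve-∀ ℚ-ring
  factor : ∀ u p q c₀ a b → u * (c₀ * (p * a) + q * c₀ * b) ≡ u * c₀ * (p * a + q * b)
  factor = solve-∀ ℚ-ring

module ZeilbergerSum (i : ℕ) where

  I : ℚ
  I = ℕ→ℚ i

  D : ℕ → ℕ → ℕ
  D m n = prod₂ (suc (2 ℕ.* i ℕ.+ 2 ℕ.* n)) m

  Sconst : ℕ → ℚ
  Sconst zero    = recip (D 0 0)
  Sconst (suc m) = Sconst m * (4 * (2 * ℕ→ℚ m + 1)) * recip (3 ℕ.+ (4 ℕ.* m ℕ.+ 2 ℕ.* i)) * recip (5 ℕ.+ (4 ℕ.* m ℕ.+ 2 ℕ.* i))

  ℕ→ℚ-odd : ∀ n → ℕ→ℚ (suc (2 ℕ.* i ℕ.+ 2 ℕ.* n)) ≡ 2 * I + 2 * ℕ→ℚ n + 1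
  ℕ→ℚ-odd n = trans (ℕ→ℚ-homo (‵ 1 ‵+ (‵ 2 ‵* ‵ i ‵+ ‵ 2 ‵* ‵ n))) (+-comm 1 (2 * I + 2 * ℕ→ℚ n))

  ℕ→ℚ-odd+ : ∀ n m → ℕ→ℚ (suc (2 ℕ.* i ℕ.+ 2 ℕ.* n) ℕ.+ 2 ℕ.* m) ≡ 2 * I + 2 * ℕ→ℚ n + 2 * ℕ→ℚ m + 1
  ℕ→ℚ-odd+ n m = trans (ℕ→ℚ-homo (‵ 1 ‵+ (‵ 2 ‵* ‵ i ‵+ ‵ 2 ‵* ‵ n) ‵+ ‵ 2 ‵* ‵ m)) (rotate 1 (2 * I + 2 * ℕ→ℚ n) (2 * ℕ→ℚ m))
    where
    rotate : ∀ a b c → a + b + c ≡ b + c + a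
    rotate = solve-∀ ℚ-ring

  ℕ→ℚ-[1+m]+i : ∀ m → ℕ→ℚ (suc m ℕ.+ i) ≡ ℕ→ℚ m + 1 + I
  ℕ→ℚ-[1+m]+i m = trans (ℕ→ℚ-homo-+ (suc m) i) (cong (_+ I) (ℕ→ℚ-suc m))

  recip-D≡recip-D[1+m]* : ∀ m n → recip (D m n) ≡ recip (D (suc m) n) * ℕ→ℚ (suc (2 ℕ.* i ℕ.+ 2 ℕ.* n) ℕ.+ 2 ℕ.* suc m)
  recip-D≡recip-D[1+m]* m n = recip-factorʳ (D m n) _

  recip-D[1+n]≡recip-D[1+m]* : ∀ m n → recip (D m (suc n)) ≡ recip (D (suc m) n) * ℕ→ℚ (suc (2 ℕ.* i ℕ.+ 2 ℕ.* n))
  recip-D[1+n]≡recip-D[1+m]* m n = begin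
    recip (D m (suc n))                  ≡⟨ cong (λ t → recip (prod₂ t m)) (odd-suc i n) ⟩
    recip (prod₂ (2 ℕ.+ s) m)            ≡⟨ recip-factorˡ (2 ℕ.* i ℕ.+ 2 ℕ.* n) (prod₂ (2 ℕ.+ s) m) ⟩
    recip (s ℕ.* prod₂ (2 ℕ.+ s) m) * ℕ→ℚ s ≡⟨ cong (λ t → recip t * ℕ→ℚ s) (prod₂-sucˡ s m) ⟨
    recip (D (suc m) n) * ℕ→ℚ s          ∎
    where
    open ≡-Reasoning
    s : ℕ
    s = suc (2 ℕ.* i ℕ.+ 2 ℕ.* n)
    odd-suc : ∀ i n → suc (2 ℕ.* i ℕ.+ 2 ℕ.* suc n) ≡ 2 ℕ.+ suc (2 ℕ.* i ℕ.+ 2 ℕ.* n)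
    odd-suc = ℕ-solve-∀

  module _ (x : ℚ) where

    U : ℕ → ℕ → ℚ
    U m n = ff (x - ℕ→ℚ (m ℕ.+ i) - 1ℚ) n

    V : ℕ → ℚ
    V r = rf (x - I) r

    F : ℕ → ℕ → ℚ
    F m n = sgn n * ℕ→ℚ (m C n) * recip (D m n) * U m n * V (m ∸ n)

    S : ℕ → ℚ
    S m = sumTo m (F m)

    N P : ℕ → ℚ
    N m = WZ.recN I (ℕ→ℚ m)
    P m = WZ.recP x (ℕ→ℚ m)

    -- Zeilberger's certificate for the recurrence N m * S (suc m) ≡ P m * S m.
    G : ℕ → ℕ → ℚ
    G m zero    = 0ℚ
    G m (suc k) = sgn (suc k) * ℕ→ℚ (m C k) * recip (D m (suc k)) * U (suc m) k * V (m ∸ k)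
                * WZ.certL x I (ℕ→ℚ m) (ℕ→ℚ (suc k))

    recip-D≡*Q₁ : ∀ m n → recip (D m (suc n)) ≡ recip (D (suc m) (suc n)) * WZ.Q₁ x I (ℕ→ℚ m) (ℕ→ℚ n)
    recip-D≡*Q₁ m n = trans (recip-D≡recip-D[1+m]* m (suc n))
      (cong (recip (D (suc m) (suc n)) *_)
            (trans (ℕ→ℚ-odd+ (suc n) (suc m)) (cong₂ (λ a b → 2 * I + 2 * a + 2 * b + 1) (ℕ→ℚ-suc n) (ℕ→ℚ-suc m))))

    recip-D≡*Q₂ : ∀ m n → recip (D m (suc (suc n))) ≡ recip (D (suc m) (suc n)) * WZ.Q₂ x I (ℕ→ℚ m) (ℕ→ℚ n)
    recip-D≡*Q₂ m n = trans (recip-D[1+n]≡recip-D[1+m]* m (suc n))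
      (cong (recip (D (suc m) (suc n)) *_) (trans (ℕ→ℚ-odd (suc n)) (cong (λ a → 2 * I + 2 * a + 1) (ℕ→ℚ-suc n))))

    U-step : ∀ m n → U (suc m) (suc n) ≡ U (suc m) n * WZ.A x I (ℕ→ℚ m) (ℕ→ℚ n)
    U-step m n = cong (λ t → U (suc m) n * (x - t - 1ℚ - ℕ→ℚ n)) (ℕ→ℚ-[1+m]+i m)

    U-head : ∀ m n → U m (suc n) ≡ WZ.C x I (ℕ→ℚ m) (ℕ→ℚ n) * U (suc m) n
    U-head m n = trans (ff-sucˡ _ n)
      (cong₂ (λ a b → (x - a - 1ℚ) * ff b n) (ℕ→ℚ-homo-+ m i)
             (trans (cong (λ t → x - t - 1ℚ - 1ℚ) (ℕ→ℚ-homo-+ m i))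
                    (trans (shift x (ℕ→ℚ m) I) (cong (λ t → x - t - 1ℚ) (sym (ℕ→ℚ-[1+m]+i m))))))
      where
      shift : ∀ x M I → x - (M + I) - 1 - 1 ≡ x - (M + 1 + I) - 1
      shift = solve-∀ ℚ-ring

    V-step : ∀ m n → n < m → V (m ∸ n) ≡ V (m ∸ suc n) * WZ.B x I (ℕ→ℚ m) (ℕ→ℚ n)
    V-step m n n<m = trans (cong V (ℕ.+-∸-assoc 1 n<m))
      (cong (λ t → V (m ∸ suc n) * (x - I + t)) (trans (ℕ→ℚ-homo-∸ n<m) (cong (λ t → ℕ→ℚ m - t) (ℕ→ℚ-suc n))))

    module InteriorStep (m n : ℕ) (n<m : n < m) where

      M ν c₀ c₁ σ : ℚ
      M  = ℕ→ℚ m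
      ν  = ℕ→ℚ n
      c₀ = ℕ→ℚ (m C n)
      c₁ = ℕ→ℚ (m C suc n)
      σ  = sgn n * recip (D (suc m) (suc n)) * U (suc m) n * V (m ∸ suc n)

      pascal : ℕ→ℚ (suc m C suc n) ≡ c₀ + c₁
      pascal = trans (cong ℕ→ℚ (sym (nCk+nC[k+1]≡[n+1]C[k+1] m n))) (ℕ→ℚ-homo-+ (m C n) (m C suc n))

      binomial-ratio : (ν + 1) * c₁ ≡ (M - ν) * c₀
      binomial-ratio = begin
        (ν + 1) * c₁                        ≡⟨ cong (_* c₁) (ℕ→ℚ-suc n) ⟨
        ℕ→ℚ (suc n) * c₁                    ≡⟨ ℕ→ℚ-homo-* (suc n) (m C suc n) ⟨
        ℕ→ℚ (suc n ℕ.* (m C suc n))         ≡⟨ cong ℕ→ℚ ([1+k]*nC[1+k]≡[n∸k]*nCk m n) ⟩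
        ℕ→ℚ ((m ∸ n) ℕ.* (m C n))           ≡⟨ ℕ→ℚ-homo-* (m ∸ n) (m C n) ⟩
        ℕ→ℚ (m ∸ n) * c₀                    ≡⟨ cong (_* c₀) (ℕ→ℚ-homo-∸ (ℕ.<⇒≤ n<m)) ⟩
        (M - ν) * c₀                        ∎
        where open ≡-Reasoning

      cofactors-vanish : c₀ * WZ.α x I M ν + c₁ * WZ.β x I M ν ≡ 0ℚ
      cofactors-vanish = proportional-zero {p = ν + 1} {q = M - ν} (recip (suc n))
        (trans (cong (recip (suc n) *_) (sym (ℕ→ℚ-suc n))) (recip-inverseˡ n)) binomial-ratio (wz-interior x I M ν)

      F-next : F (suc m) (suc n) ≡ σ * (- (c₀ + c₁) * WZ.A x I M ν * WZ.B x I M ν)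
      F-next = trans (cong₃ (λ c u v → - sgn n * c * recip (D (suc m) (suc n)) * u * v) pascal (U-step m n) (V-step m n n<m))
                     (regroup (sgn n) (c₀ + c₁) (recip (D (suc m) (suc n))) (U (suc m) n) (V (m ∸ suc n)) _ _)
        where
        regroup : ∀ s k e U V a b → - s * k * e * (U * a) * (V * b) ≡ s * e * U * V * (- k * a * b)
        regroup = solve-∀ ℚ-ring

      F-same : F m (suc n) ≡ σ * (- c₁ * WZ.Q₁ x I M ν * WZ.C x I M ν)
      F-same = trans (cong₂ (λ e u → - sgn n * c₁ * e * u * V (m ∸ suc n)) (recip-D≡*Q₁ m n) (U-head m n))
                     (regroup (sgn n) c₁ (recip (D (suc m) (suc n))) (U (suc m) n) (V (m ∸ suc n)) _ _)
        where
        regroup : ∀ s k e U V q c → - s * k * (e * q) * (c * U) * V ≡ s * e * U * V * (- k * q * c)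
        regroup = solve-∀ ℚ-ring

      G-next : G m (suc (suc n)) ≡ σ * (c₁ * WZ.Q₂ x I M ν * WZ.A x I M ν * WZ.certL x I M (ν + 2))
      G-next = trans (cong₃ (λ e u l → - - sgn n * c₁ * e * u * V (m ∸ suc n) * WZ.certL x I M l)
                            (recip-D≡*Q₂ m n) (U-step m n) (trans (ℕ→ℚ-homo-+ 2 n) (+-comm 2 ν)))
                     (regroup (sgn n) c₁ (recip (D (suc m) (suc n))) (U (suc m) n) (V (m ∸ suc n)) _ _ _)
        where
        regroup : ∀ s k e U V q a l → - - s * k * (e * q) * (U * a) * V * l ≡ s * e * U * V * (k * q * a * l)
        regroup = solve-∀ ℚ-ring

      G-same : G m (suc n) ≡ σ * (- c₀ * WZ.Q₁ x I M ν * WZ.B x I M ν * WZ.certL x I M (ν + 1))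
      G-same = trans (cong₃ (λ e v l → - sgn n * c₀ * e * U (suc m) n * v * WZ.certL x I M l)
                            (recip-D≡*Q₁ m n) (V-step m n n<m) (ℕ→ℚ-suc n))
                     (regroup (sgn n) c₀ (recip (D (suc m) (suc n))) (U (suc m) n) (V (m ∸ suc n)) _ _ _)
        where
        regroup : ∀ s k e U V q b l → - s * k * (e * q) * U * (V * b) * l ≡ s * e * U * V * (- k * q * b * l)
        regroup = solve-∀ ℚ-ring

      step : N m * F (suc m) (suc n) - P m * F m (suc n) ≡ G m (suc (suc n)) - G m (suc n)
      step = begin
        N m * F (suc m) (suc n) - P m * F m (suc n)
          ≡⟨ cong₂ (λ u v → N m * u - P m * v) F-next F-same ⟩
        N m * (σ * (- (c₀ + c₁) * a * b)) - P m * (σ * (- c₁ * q₁ * c))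
          ≡⟨ regroup σ c₀ c₁ (N m) (P m) a b c q₁ q₂ (WZ.certL x I M (ν + 1)) (WZ.certL x I M (ν + 2)) ⟩
        σ * (c₀ * WZ.α x I M ν + c₁ * WZ.β x I M ν) + (σ * T₃ - σ * T₄)
          ≡⟨ cong (λ z → σ * z + (σ * T₃ - σ * T₄)) cofactors-vanish ⟩
        σ * 0ℚ + (σ * T₃ - σ * T₄)
          ≡⟨ cong (_+ (σ * T₃ - σ * T₄)) (*-zeroʳ σ) ⟩
        0ℚ + (σ * T₃ - σ * T₄)
          ≡⟨ +-identityˡ (σ * T₃ - σ * T₄) ⟩
        σ * T₃ - σ * T₄
          ≡⟨ cong₂ _-_ G-next G-same ⟨
        G m (suc (suc n)) - G m (suc n) ∎
        where
        open ≡-Reasoning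
        a b c q₁ q₂ T₃ T₄ : ℚ
        a  = WZ.A x I M ν
        b  = WZ.B x I M ν
        c  = WZ.C x I M ν
        q₁ = WZ.Q₁ x I M ν
        q₂ = WZ.Q₂ x I M ν
        T₃ = c₁ * q₂ * a * WZ.certL x I M (ν + 2)
        T₄ = - c₀ * q₁ * b * WZ.certL x I M (ν + 1)
        regroup : ∀ σ c₀ c₁ N P a b c q₁ q₂ L₁ L₂ →
          N * (σ * (- (c₀ + c₁) * a * b)) - P * (σ * (- c₁ * q₁ * c))
            ≡ σ * (c₀ * (- N * a * b - q₁ * b * L₁) + c₁ * (- N * a * b + P * q₁ * c - q₂ * a * L₂))
              + (σ * (c₁ * q₂ * a * L₂) - σ * (- c₀ * q₁ * b * L₁))
        regroup = solve-∀ ℚ-ring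

    F-beyond : ∀ m → F m (suc m) ≡ 0ℚ
    F-beyond m rewrite k>n⇒nCk≡0 {m} {suc m} ℕ.≤-refl = vanish (sgn (suc m)) (recip (D m (suc m))) (U m (suc m)) (V (m ∸ suc m))
      where
      vanish : ∀ s e u v → s * 0 * e * u * v ≡ 0
      vanish = solve-∀ ℚ-ring

    G-beyond : ∀ m → G m (suc (suc m)) ≡ 0ℚ
    G-beyond m rewrite k>n⇒nCk≡0 {m} {suc m} ℕ.≤-refl =
      vanish (sgn (suc (suc m))) (recip (D m (suc (suc m)))) (U (suc m) (suc m)) (V (m ∸ suc m)) (WZ.certL x I (ℕ→ℚ m) (ℕ→ℚ (suc (suc m))))
      where
      vanish : ∀ s e u v l → s * 0 * e * u * v * l ≡ 0
      vanish = solve-∀ ℚ-ring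

    step-bottom : ∀ m → N m * F (suc m) 0 - P m * F m 0 ≡ G m 1 - G m 0
    step-bottom m = begin
      N m * F (suc m) 0 - P m * F m 0
        ≡⟨ cong (λ e → N m * F (suc m) 0 - P m * (1ℚ * 1ℚ * e * 1ℚ * V m)) recip-D-m-0 ⟩
      N m * (1ℚ * 1ℚ * ε * 1ℚ * (V m * (x - I + M))) - P m * (1ℚ * 1ℚ * (ε * (2 * I + 2 * 0 + 2 * (M + 1) + 1)) * 1ℚ * V m)
        ≡⟨ factor-out (N m) (P m) ε (V m) I M (x - I + M) ⟩
      ε * V m * (N m * (x - I + M) - P m * (2 * I + 2 * (M + 1) + 1))
        ≡⟨ cong (ε * V m *_) (wz-bottom x I M) ⟩
      ε * V m * (- (2 * I + 1) * WZ.certL x I M 1)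
        ≡⟨ factor-in ε (V m) I (WZ.certL x I M 1) ⟩
      - 1 * 1 * (ε * (2 * I + 2 * 0 + 1)) * 1 * V m * WZ.certL x I M 1 - 0
        ≡⟨ cong (λ e → - 1 * 1 * e * 1 * V m * WZ.certL x I M 1 - 0) (sym recip-D-1-m) ⟩
      G m 1 - G m 0 ∎
      where
      open ≡-Reasoning
      M ε : ℚ
      M = ℕ→ℚ m
      ε = recip (D (suc m) 0)
      recip-D-m-0 : recip (D m 0) ≡ ε * (2 * I + 2 * 0 + 2 * (M + 1) + 1)
      recip-D-m-0 = trans (recip-D≡recip-D[1+m]* m 0)
        (cong (ε *_) (trans (ℕ→ℚ-odd+ 0 (suc m)) (cong (λ t → 2 * I + 2 * 0 + 2 * t + 1) (ℕ→ℚ-suc m))))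
      recip-D-1-m : recip (D m 1) ≡ ε * (2 * I + 2 * 0 + 1)
      recip-D-1-m = trans (recip-D[1+n]≡recip-D[1+m]* m 0) (cong (ε *_) (ℕ→ℚ-odd 0))
      factor-out : ∀ N P ε V I M b →
        N * (1 * 1 * ε * 1 * (V * b)) - P * (1 * 1 * (ε * (2 * I + 2 * 0 + 2 * (M + 1) + 1)) * 1 * V)
          ≡ ε * V * (N * b - P * (2 * I + 2 * (M + 1) + 1))
      factor-out = solve-∀ ℚ-ring
      factor-in : ∀ ε V I L → ε * V * (- (2 * I + 1) * L) ≡ - 1 * 1 * (ε * (2 * I + 2 * 0 + 1)) * 1 * V * L - 0
      factor-in = solve-∀ ℚ-ring

    step-top : ∀ m → N m * F (suc m) (suc m) - P m * F m (suc m) ≡ G m (suc (suc m)) - G m (suc m)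
    step-top m = begin
      N m * F (suc m) (suc m) - P m * F m (suc m)
        ≡⟨ cong₂ (λ u v → N m * u - P m * v) F-diagonal (F-beyond m) ⟩
      N m * (- s * 1 * ε * (U₀ * WZ.A x I M M) * 1) - P m * 0
        ≡⟨ factor-out s ε U₀ (N m) (P m) (WZ.A x I M M) ⟩
      - s * ε * U₀ * (N m * WZ.A x I M M)
        ≡⟨ cong (- s * ε * U₀ *_) (wz-top x I M) ⟩
      - s * ε * U₀ * (- WZ.Q₁ x I M M * WZ.certL x I M (M + 1))
        ≡⟨ factor-in s ε U₀ (WZ.Q₁ x I M M) (WZ.certL x I M (M + 1)) ⟩
      0 - - s * 1 * (ε * WZ.Q₁ x I M M) * U₀ * 1 * WZ.certL x I M (M + 1)
        ≡⟨ cong₂ _-_ (G-beyond m) G-diagonal ⟨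
      G m (suc (suc m)) - G m (suc m) ∎
      where
      open ≡-Reasoning
      M s ε U₀ : ℚ
      M  = ℕ→ℚ m
      s  = sgn m
      ε  = recip (D (suc m) (suc m))
      U₀ = U (suc m) m
      V-empty : V (m ∸ m) ≡ 1
      V-empty = cong V (ℕ.n∸n≡0 m)
      F-diagonal : F (suc m) (suc m) ≡ - s * 1 * ε * (U₀ * WZ.A x I M M) * 1
      F-diagonal = cong₃ (λ c u v → - s * c * ε * u * v) (cong ℕ→ℚ (nCn≡1 (suc m))) (U-step m m) V-empty
      G-diagonal : G m (suc m) ≡ - s * 1 * (ε * WZ.Q₁ x I M M) * U₀ * 1 * WZ.certL x I M (M + 1)
      G-diagonal = trans (cong₂ (λ c e → - s * c * e * U₀ * V (m ∸ m) * WZ.certL x I M (ℕ→ℚ (suc m)))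
                                (cong ℕ→ℚ (nCn≡1 m)) (recip-D≡*Q₁ m m))
                         (cong₂ (λ v l → - s * 1 * (ε * WZ.Q₁ x I M M) * U₀ * v * WZ.certL x I M l) V-empty (ℕ→ℚ-suc m))
      factor-out : ∀ s ε U N P a → N * (- s * 1 * ε * (U * a) * 1) - P * 0 ≡ - s * ε * U * (N * a)
      factor-out = solve-∀ ℚ-ring
      factor-in : ∀ s ε U q l → - s * ε * U * (- q * l) ≡ 0 - - s * 1 * (ε * q) * U * 1 * l
      factor-in = solve-∀ ℚ-ring

    telescoping : ∀ m k → k ≤ suc m → N m * F (suc m) k - P m * F m k ≡ G m (suc k) - G m k
    telescoping m zero    _         = step-bottom m
    telescoping m (suc n) (s≤s n≤m) = [ InteriorStep.step m n , top ]′ (ℕ.m≤n⇒m<n∨m≡n n≤m)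
      where
      top : n ≡ m → N m * F (suc m) (suc n) - P m * F m (suc n) ≡ G m (suc (suc n)) - G m (suc n)
      top n≡m = subst (λ j → N m * F (suc m) (suc j) - P m * F m (suc j) ≡ G m (suc (suc j)) - G m (suc j))
                      (sym n≡m) (step-top m)

    S-recurrence : ∀ m → N m * S (suc m) ≡ P m * S m
    S-recurrence m = difference-zero (begin
      N m * S (suc m) - P m * S m                                  ≡⟨ cong (λ t → N m * S (suc m) - P m * t) (+-identityʳ (S m)) ⟨
      N m * S (suc m) - P m * (S m + 0ℚ)                           ≡⟨ cong (λ t → N m * S (suc m) - P m * (S m + t)) (F-beyond m) ⟨
      N m * S (suc m) - P m * sumTo (suc m) (F m)                  ≡⟨ cong₂ _-_ (sumTo-*ˡ (suc m) (N m) (F (suc m))) (sumTo-*ˡ (suc m) (P m) (F m)) ⟨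
      sumTo (suc m) (λ k → N m * F (suc m) k) - sumTo (suc m) (λ k → P m * F m k)
                                                                   ≡⟨ sumTo-sub (suc m) _ _ ⟨
      sumTo (suc m) (λ k → N m * F (suc m) k - P m * F m k)        ≡⟨ sumTo-telescope (suc m) _ (G m) (telescoping m) ⟩
      G m (suc (suc m)) - G m 0                                    ≡⟨ cong (_- 0ℚ) (G-beyond m) ⟩
      0ℚ - 0ℚ                                                      ≡⟨⟩
      0ℚ                                                           ∎)
      where
      open ≡-Reasoning
      difference-zero : ∀ {a b} → a - b ≡ 0ℚ → a ≡ b
      difference-zero {a} {b} a-b≡0 = trans (add-back a b) (trans (cong (_+ b) a-b≡0) (+-identityˡ b))
        where
        add-back : ∀ a b → a ≡ a - b + b
        add-back = solve-∀ ℚ-ring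

    S-closed : ∀ m → S m ≡ Sconst m * ff (x + ℕ→ℚ m - ½) m
    S-closed zero    = shuffle (recip (D 0 0))
      where
      shuffle : ∀ k → 1 * 1 * k * 1 * 1 ≡ k * 1
      shuffle = solve-∀ ℚ-ring
    S-closed (suc m) = begin
      S (suc m)                                  ≡⟨ *-identityˡ (S (suc m)) ⟨
      1ℚ * S (suc m)                             ≡⟨ cong (_* S (suc m)) (cong₂ _*_ (recip-inverseˡ (2 ℕ.+ (4 ℕ.* m ℕ.+ 2 ℕ.* i))) (recip-inverseˡ (4 ℕ.+ (4 ℕ.* m ℕ.+ 2 ℕ.* i)))) ⟨
      ra * ℕ→ℚ a * (rb * ℕ→ℚ b) * S (suc m)      ≡⟨ cong₂ (λ u v → ra * u * (rb * v) * S (suc m)) (cast 3) (cast 5) ⟩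
      ra * (4 * M + 2 * I + 3) * (rb * (4 * M + 2 * I + 5)) * S (suc m)
                                                 ≡⟨ separate ra rb M I (S (suc m)) ⟩
      ra * rb * (N m * S (suc m))                ≡⟨ cong (ra * rb *_) (S-recurrence m) ⟩
      ra * rb * (P m * S m)                      ≡⟨ cong (λ t → ra * rb * (P m * t)) (S-closed m) ⟩
      ra * rb * (P m * (Sconst m * Φ))           ≡⟨ regroup ra rb x M (Sconst m) Φ ⟩
      Sconst (suc m) * ((x + M + ½) * Φ)         ≡⟨ cong (Sconst (suc m) *_) Φ-step ⟩
      Sconst (suc m) * ff (x + ℕ→ℚ (suc m) - ½) (suc m) ∎
      where
      open ≡-Reasoning
      a b : ℕ
      a = 3 ℕ.+ (4 ℕ.* m ℕ.+ 2 ℕ.* i)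
      b = 5 ℕ.+ (4 ℕ.* m ℕ.+ 2 ℕ.* i)
      M ra rb Φ : ℚ
      M  = ℕ→ℚ m
      ra = recip a
      rb = recip b
      Φ  = ff (x + M - ½) m
      cast : ∀ c → ℕ→ℚ (c ℕ.+ (4 ℕ.* m ℕ.+ 2 ℕ.* i)) ≡ 4 * M + 2 * I + ℕ→ℚ c
      cast c = trans (ℕ→ℚ-homo (‵ c ‵+ (‵ 4 ‵* ‵ m ‵+ ‵ 2 ‵* ‵ i))) (+-comm (ℕ→ℚ c) (4 * M + 2 * I))
      separate : ∀ ra rb M I S →
        ra * (4 * M + 2 * I + 3) * (rb * (4 * M + 2 * I + 5)) * S ≡ ra * rb * ((4 * M + 2 * I + 3) * (4 * M + 2 * I + 5) * S)
      separate = solve-∀ ℚ-ring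
      regroup : ∀ ra rb x M K Φ →
        ra * rb * (4 * (2 * M + 1) * (x + M + ½) * (K * Φ)) ≡ K * (4 * (2 * M + 1)) * ra * rb * ((x + M + ½) * Φ)
      regroup = solve-∀ ℚ-ring
      Φ-step : (x + M + ½) * Φ ≡ ff (x + ℕ→ℚ (suc m) - ½) (suc m)
      Φ-step = sym (trans (ff-sucˡ _ m)
        (trans (cong (λ t → (x + t - ½) * ff (x + t - ½ - 1ℚ) m) (ℕ→ℚ-suc m))
               (cong₂ (λ u v → u * ff v m) (half-up x M) (half-down x M))))
        where
        half-up : ∀ x M → x + (M + 1) - ½ ≡ x + M + ½
        half-up = solve-∀ ℚ-ring
        half-down : ∀ x M → x + (M + 1) - ½ - 1 ≡ x + M - ½
        half-down = solve-∀ ℚ-ring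

-- f̃ on the lines x + y + m = 0 and x + y = m

ftilde-summand : ℕ → ℕ → ℚ → ℚ → ℕ → ℚ
ftilde-summand m i x y k =
  ff (x + ℕ→ℚ (pp m i ∸ k)) (2 ℕ.* (pp m i ∸ k) ℕ.+ 1) * (ff (y + ℕ→ℚ (m ℕ.+ i)) k * ff (y + ℕ→ℚ k - ℕ→ℚ (m ℕ.+ i ℕ.+ 1)) k)

ftilde≡sumTo : ∀ m i x y → ftilde m i x y ≡ sumTo m (λ k → coef m i k * ftilde-summand m i x y k)
ftilde≡sumTo m i x y = sumTo-cong m (λ k _ → assoc (coef m i k) _ _ _)
  where
  assoc : ∀ c a b d → c * a * b * d ≡ c * (a * (b * d))
  assoc = solve-∀ ℚ-ring

ftilde-odd : ∀ m i x y → ftilde m i (- x) (- y) ≡ - ftilde m i x y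
ftilde-odd m i x y = begin
  ftilde m i (- x) (- y)                                          ≡⟨ ftilde≡sumTo m i (- x) (- y) ⟩
  sumTo m (λ k → coef m i k * ftilde-summand m i (- x) (- y) k)   ≡⟨ sumTo-cong m (λ k _ → summand-odd k) ⟩
  sumTo m (λ k → - (coef m i k * ftilde-summand m i x y k))       ≡⟨ sumTo-neg m _ ⟩
  - sumTo m (λ k → coef m i k * ftilde-summand m i x y k)         ≡⟨ cong -_ (ftilde≡sumTo m i x y) ⟨
  - ftilde m i x y                                                ∎
  where
  open ≡-Reasoning
  summand-odd : ∀ k → coef m i k * ftilde-summand m i (- x) (- y) k ≡ - (coef m i k * ftilde-summand m i x y k)
  summand-odd k = trans (cong₂ (λ u v → coef m i k * (u * v)) (ff-odd (pp m i ∸ k) x) (ff-pair-even k y (ℕ→ℚ-homo-+ (m ℕ.+ i) 1)))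
                        (negate (coef m i k) (ff (x + ℕ→ℚ (pp m i ∸ k)) (2 ℕ.* (pp m i ∸ k) ℕ.+ 1))
                                (ff (y + ℕ→ℚ (m ℕ.+ i)) k * ff (y + ℕ→ℚ k - ℕ→ℚ (m ℕ.+ i ℕ.+ 1)) k))
    where
    negate : ∀ c u v → c * (- u * v) ≡ - (c * (u * v))
    negate = solve-∀ ℚ-ring

ftilde-summand-on-line : ∀ i m k n x → k ℕ.+ n ≡ m →
  ftilde-summand m i x (- x - ℕ→ℚ m) k
    ≡ ff (x + ℕ→ℚ (2 ℕ.* m ℕ.+ i)) (3 ℕ.* m ℕ.+ 2 ℕ.* i ℕ.+ 1) * (ZeilbergerSum.U i x m n * ZeilbergerSum.V i x k)
ftilde-summand-on-line i .(k ℕ.+ n) k n x refl = begin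
  ff (x + ℕ→ℚ (pp m i ∸ k)) (2 ℕ.* (pp m i ∸ k) ℕ.+ 1) * (ff (y + ℕ→ℚ (m ℕ.+ i)) k * ff (y + K - ℕ→ℚ (m ℕ.+ i ℕ.+ 1)) k)
    ≡⟨ cong₃ (λ p u v → ff (x + ℕ→ℚ p) (2 ℕ.* p ℕ.+ 1) * (u * v)) pp∸k≡p Y₁ Y₂ ⟩
  ff (x + ℕ→ℚ p) (2 ℕ.* p ℕ.+ 1) * (sgn k * V * (sgn k * ff a k))
    ≡⟨ regroup (ff (x + ℕ→ℚ p) (2 ℕ.* p ℕ.+ 1)) (sgn k) V (ff a k) ⟩
  sgn k * sgn k * (ff a k * ff (x + ℕ→ℚ p) (2 ℕ.* p ℕ.+ 1)) * V
    ≡⟨ cong₂ (λ s t → s * t * V) (sgn-square k) merge ⟩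
  1ℚ * (ff a L * U) * V
    ≡⟨ drop-one (ff a L) U V ⟩
  ff a L * (U * V) ∎
  where
  open ≡-Reasoning
  m p L : ℕ
  m = k ℕ.+ n
  p = k ℕ.+ 2 ℕ.* n ℕ.+ i
  L = 3 ℕ.* m ℕ.+ 2 ℕ.* i ℕ.+ 1
  K N I M y a U V : ℚ
  K = ℕ→ℚ k
  N = ℕ→ℚ n
  I = ℕ→ℚ i
  M = ℕ→ℚ m
  y = - x - M
  a = x + ℕ→ℚ (2 ℕ.* m ℕ.+ i)
  U = ZeilbergerSum.U i x m n
  V = ZeilbergerSum.V i x k
  pp∸k≡p : pp m i ∸ k ≡ p
  pp∸k≡p = trans (cong (_∸ k) (spread k n i)) (ℕ.m+n∸m≡n k p)
    where
    spread : ∀ k n i → 2 ℕ.* (k ℕ.+ n) ℕ.+ i ≡ k ℕ.+ (k ℕ.+ 2 ℕ.* n ℕ.+ i)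
    spread = ℕ-solve-∀
  Y₁ : ff (y + ℕ→ℚ (m ℕ.+ i)) k ≡ sgn k * V
  Y₁ = trans (cong (λ t → ff (y + t) k) (ℕ→ℚ-homo-+ m i))
             (trans (cong (λ t → ff t k) (flip x M I)) (ff-neg (x - I) k))
    where
    flip : ∀ x M I → - x - M + (M + I) ≡ - (x - I)
    flip = solve-∀ ℚ-ring
  Y₂ : ff (y + K - ℕ→ℚ (m ℕ.+ i ℕ.+ 1)) k ≡ sgn k * ff a k
  Y₂ = ff-reflect (a - K + 1ℚ) k
         (trans (cong (λ t → y + K - t) (ℕ→ℚ-homo (‵ m ‵+ ‵ i ‵+ ‵ 1)))
                (trans (flip x K M I) (cong (λ t → - (x + t - K + 1ℚ)) (sym (ℕ→ℚ-homo (‵ 2 ‵* ‵ m ‵+ ‵ i))))))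
         (cancel a K)
    where
    flip : ∀ x K M I → - x - M + K - (M + I + 1) ≡ - (x + (2 * M + I) - K + 1)
    flip = solve-∀ ℚ-ring
    cancel : ∀ a K → a - K + 1 + K - 1 ≡ a
    cancel = solve-∀ ℚ-ring
  merge : ff a k * ff (x + ℕ→ℚ p) (2 ℕ.* p ℕ.+ 1) ≡ ff a L * U
  merge = begin
    ff a k * ff (x + ℕ→ℚ p) (2 ℕ.* p ℕ.+ 1)       ≡⟨ cong (λ t → ff a k * ff t (2 ℕ.* p ℕ.+ 1)) a-K ⟨
    ff a k * ff (a - K) (2 ℕ.* p ℕ.+ 1)           ≡⟨ ff-+ a k (2 ℕ.* p ℕ.+ 1) ⟨
    ff a (k ℕ.+ (2 ℕ.* p ℕ.+ 1))                  ≡⟨ cong (ff a) (lengths k n i) ⟩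
    ff a (L ℕ.+ n)                                ≡⟨ ff-+ a L n ⟩
    ff a L * ff (a - ℕ→ℚ L) n                     ≡⟨ cong (λ t → ff a L * ff t n) a-L ⟩
    ff a L * U                                    ∎
    where
    lengths : ∀ k n i → k ℕ.+ (2 ℕ.* (k ℕ.+ 2 ℕ.* n ℕ.+ i) ℕ.+ 1) ≡ 3 ℕ.* (k ℕ.+ n) ℕ.+ 2 ℕ.* i ℕ.+ 1 ℕ.+ n
    lengths = ℕ-solve-∀
    shift-K : ∀ x K N I → x + (2 * (K + N) + I) - K ≡ x + (K + 2 * N + I)
    shift-K = solve-∀ ℚ-ring
    a-K : a - K ≡ x + ℕ→ℚ p
    a-K = trans (cong (λ t → x + t - K) (ℕ→ℚ-homo (‵ 2 ‵* (‵ k ‵+ ‵ n) ‵+ ‵ i)))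
                (trans (shift-K x K N I) (cong (λ t → x + t) (sym (ℕ→ℚ-homo (‵ k ‵+ ‵ 2 ‵* ‵ n ‵+ ‵ i)))))
    shift-L : ∀ x M I → x + (2 * M + I) - (3 * M + 2 * I + 1) ≡ x - (M + I) - 1
    shift-L = solve-∀ ℚ-ring
    a-L : a - ℕ→ℚ L ≡ x - ℕ→ℚ (m ℕ.+ i) - 1ℚ
    a-L = trans (cong₂ (λ s t → x + s - t) (ℕ→ℚ-homo (‵ 2 ‵* ‵ m ‵+ ‵ i)) (ℕ→ℚ-homo (‵ 3 ‵* ‵ m ‵+ ‵ 2 ‵* ‵ i ‵+ ‵ 1)))
                (trans (shift-L x M I) (cong (λ t → x - t - 1ℚ) (sym (ℕ→ℚ-homo-+ m i))))
  regroup : ∀ X s V F → X * (s * V * (s * F)) ≡ s * s * (F * X) * V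
  regroup = solve-∀ ℚ-ring
  drop-one : ∀ A B C → 1 * (A * B) * C ≡ A * (B * C)
  drop-one = solve-∀ ℚ-ring

ftilde-on-line : ∀ i m x →
  ftilde m i x (- x - ℕ→ℚ m) ≡ evenFactorial m * ff (x + ℕ→ℚ (2 ℕ.* m ℕ.+ i)) (3 ℕ.* m ℕ.+ 2 ℕ.* i ℕ.+ 1) * ZeilbergerSum.S i x m
ftilde-on-line i m x = begin
  ftilde m i x y                                          ≡⟨ ftilde≡sumTo m i x y ⟩
  sumTo m (λ k → coef m i k * ftilde-summand m i x y k)   ≡⟨ sumTo-cong m term ⟩
  sumTo m (λ k → β * X * F (m ∸ k))                       ≡⟨ sumTo-*ˡ m (β * X) (λ k → F (m ∸ k)) ⟩
  β * X * sumTo m (λ k → F (m ∸ k))                       ≡⟨ cong (β * X *_) (sumTo-reverse m F) ⟨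
  β * X * ZeilbergerSum.S i x m                           ∎
  where
  open ≡-Reasoning
  y β X : ℚ
  y = - x - ℕ→ℚ m
  β = evenFactorial m
  X = ff (x + ℕ→ℚ (2 ℕ.* m ℕ.+ i)) (3 ℕ.* m ℕ.+ 2 ℕ.* i ℕ.+ 1)
  F : ℕ → ℚ
  F = ZeilbergerSum.F i x m
  regroup : ∀ s c β r X u v → s * c * (β * r) * (X * (u * v)) ≡ β * X * (s * c * r * u * v)
  regroup = solve-∀ ℚ-ring
  term : ∀ k → k ≤ m → coef m i k * ftilde-summand m i x y k ≡ β * X * F (m ∸ k)
  term k k≤m = begin
    coef m i k * ftilde-summand m i x y k
      ≡⟨ cong₂ _*_ (coef-closed m i k) (ftilde-summand-on-line i m k n x (ℕ.m+[n∸m]≡n k≤m)) ⟩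
    sgn n * ℕ→ℚ (m C n) * (β * recip (D m n)) * (X * (U x m n * V x k))
      ≡⟨ regroup (sgn n) (ℕ→ℚ (m C n)) β (recip (D m n)) X (U x m n) (V x k) ⟩
    β * X * (sgn n * ℕ→ℚ (m C n) * recip (D m n) * U x m n * V x k)
      ≡⟨ cong (λ j → β * X * (sgn n * ℕ→ℚ (m C n) * recip (D m n) * U x m n * V x j)) (ℕ.m∸[m∸n]≡n k≤m) ⟨
    β * X * F n ∎
    where
    open ZeilbergerSum i using (D; U; V)
    n : ℕ
    n = m ∸ k

constA : ℕ → ℕ → ℚ
constA i m = ℕ→ℚ 2 * evenFactorial m * ZeilbergerSum.Sconst i m

twice-ftilde-on-line : ∀ i m x →
  ℕ→ℚ 2 * ftilde m i x (- x - ℕ→ℚ m)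
    ≡ constA i m * ff (x + ℕ→ℚ (2 ℕ.* m ℕ.+ i)) (3 ℕ.* m ℕ.+ 2 ℕ.* i ℕ.+ 1) * ff (x + ℕ→ℚ m - ½) m
twice-ftilde-on-line i m x = trans
  (cong (ℕ→ℚ 2 *_) (trans (ftilde-on-line i m x) (cong (evenFactorial m * X *_) (ZeilbergerSum.S-closed i x m))))
  (regroup (ℕ→ℚ 2) (evenFactorial m) X (ZeilbergerSum.Sconst i m) (ff (x + ℕ→ℚ m - ½) m))
  where
  X : ℚ
  X = ff (x + ℕ→ℚ (2 ℕ.* m ℕ.+ i)) (3 ℕ.* m ℕ.+ 2 ℕ.* i ℕ.+ 1)
  regroup : ∀ t b X K Φ → t * (b * X * (K * Φ)) ≡ t * b * K * X * Φ
  regroup = solve-∀ ℚ-ring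

twice-ftilde-neg : ∀ m i x y → ℕ→ℚ 2 * ftilde m i x y ≡ - (ℕ→ℚ 2 * ftilde m i (- x) (- y))
twice-ftilde-neg m i x y = begin
  ℕ→ℚ 2 * ftilde m i x y                  ≡⟨ cong₂ (λ u v → ℕ→ℚ 2 * ftilde m i u v) (double-neg x) (double-neg y) ⟩
  ℕ→ℚ 2 * ftilde m i (- - x) (- - y)      ≡⟨ cong (ℕ→ℚ 2 *_) (ftilde-odd m i (- x) (- y)) ⟩
  ℕ→ℚ 2 * - ftilde m i (- x) (- y)        ≡⟨ neg-distribʳ-* (ℕ→ℚ 2) (ftilde m i (- x) (- y)) ⟨
  - (ℕ→ℚ 2 * ftilde m i (- x) (- y))      ∎
  where
  open ≡-Reasoning
  double-neg : ∀ a → a ≡ - - a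
  double-neg = solve-∀ ℚ-ring

sgn-L+m : ∀ i m → sgn (3 ℕ.* m ℕ.+ 2 ℕ.* i ℕ.+ 1) * sgn m ≡ - 1ℚ
sgn-L+m i m = trans (sym (sgn-homo-+ (3 ℕ.* m ℕ.+ 2 ℕ.* i ℕ.+ 1) m)) (trans (cong sgn (odd-sum m i)) (sgn-odd (2 ℕ.* m ℕ.+ i)))
  where
  odd-sum : ∀ m i → 3 ℕ.* m ℕ.+ 2 ℕ.* i ℕ.+ 1 ℕ.+ m ≡ 2 ℕ.* (2 ℕ.* m ℕ.+ i) ℕ.+ 1
  odd-sum = ℕ-solve-∀

rhs-a-on-line : ∀ i m x → let y = - x - ℕ→ℚ m in
  ff (y + ℕ→ℚ (2 ℕ.* m ℕ.+ i)) (3 ℕ.* m ℕ.+ 2 ℕ.* i ℕ.+ 1) * ff (y + ℕ→ℚ m - ½) m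
    ≡ - (ff (x + ℕ→ℚ (2 ℕ.* m ℕ.+ i)) (3 ℕ.* m ℕ.+ 2 ℕ.* i ℕ.+ 1) * ff (x + ℕ→ℚ m - ½) m)
rhs-a-on-line i m x = ff-reflect-pair (3 ℕ.* m ℕ.+ 2 ℕ.* i ℕ.+ 1) m (x - M - I) (x + ½) (sgn-L+m i m)
  (trans (cong (λ t → - x - M + t) [2m+i]) (flip₁ x M I))
  (trans (cong (λ s → x - M - I + s - 1ℚ) [3m+2i+1]) (trans (shift₁ x M I) (cong (λ t → x + t) (sym [2m+i]))))
  (flip₂ x M) (shift₂ x M)
  where
  M I : ℚ
  M = ℕ→ℚ m
  I = ℕ→ℚ i
  [2m+i] : ℕ→ℚ (2 ℕ.* m ℕ.+ i) ≡ 2 * M + I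
  [2m+i] = ℕ→ℚ-homo (‵ 2 ‵* ‵ m ‵+ ‵ i)
  [3m+2i+1] : ℕ→ℚ (3 ℕ.* m ℕ.+ 2 ℕ.* i ℕ.+ 1) ≡ 3 * M + 2 * I + 1
  [3m+2i+1] = ℕ→ℚ-homo (‵ 3 ‵* ‵ m ‵+ ‵ 2 ‵* ‵ i ‵+ ‵ 1)
  flip₁ : ∀ x M I → - x - M + (2 * M + I) ≡ - (x - M - I)
  flip₁ = solve-∀ ℚ-ring
  shift₁ : ∀ x M I → x - M - I + (3 * M + 2 * I + 1) - 1 ≡ x + (2 * M + I)
  shift₁ = solve-∀ ℚ-ring
  flip₂ : ∀ x M → - x - M + M - ½ ≡ - (x + ½)
  flip₂ = solve-∀ ℚ-ring
  shift₂ : ∀ x M → x + ½ + M - 1 ≡ x + M - ½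
  shift₂ = solve-∀ ℚ-ring

rhs-a-neg : ∀ i m z →
  ff (- z + ℕ→ℚ (2 ℕ.* m ℕ.+ i)) (3 ℕ.* m ℕ.+ 2 ℕ.* i ℕ.+ 1) * ff (- z + ℕ→ℚ m - ½) m
    ≡ - (ff (z + ℕ→ℚ (m ℕ.+ i)) (3 ℕ.* m ℕ.+ 2 ℕ.* i ℕ.+ 1) * ff (z - ½) m)
rhs-a-neg i m z = ff-reflect-pair (3 ℕ.* m ℕ.+ 2 ℕ.* i ℕ.+ 1) m (z - ℕ→ℚ (2 ℕ.* m ℕ.+ i)) (z - M + ½) (sgn-L+m i m)
  (flip₁ z (ℕ→ℚ (2 ℕ.* m ℕ.+ i)))
  (trans (cong₂ (λ s t → z - s + t - 1ℚ) (ℕ→ℚ-homo (‵ 2 ‵* ‵ m ‵+ ‵ i)) (ℕ→ℚ-homo (‵ 3 ‵* ‵ m ‵+ ‵ 2 ‵* ‵ i ‵+ ‵ 1)))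
         (trans (shift₁ z M I) (cong (λ t → z + t) (sym (ℕ→ℚ-homo-+ m i)))))
  (flip₂ z M) (shift₂ z M)
  where
  M I : ℚ
  M = ℕ→ℚ m
  I = ℕ→ℚ i
  flip₁ : ∀ z c → - z + c ≡ - (z - c)
  flip₁ = solve-∀ ℚ-ring
  shift₁ : ∀ z M I → z - (2 * M + I) + (3 * M + 2 * I + 1) - 1 ≡ z + (M + I)
  shift₁ = solve-∀ ℚ-ring
  flip₂ : ∀ z M → - z + M - ½ ≡ - (z - M + ½)
  flip₂ = solve-∀ ℚ-ring
  shift₂ : ∀ z M → z - M + ½ + M - 1 ≡ z - ½
  shift₂ = solve-∀ ℚ-ring

neg-swap : ∀ {a b} → a ≡ - b → b ≡ - a
neg-swap {a} {b} a≡-b = trans (double-neg b) (cong -_ (sym a≡-b))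
  where
  double-neg : ∀ b → b ≡ - - b
  double-neg = solve-∀ ℚ-ring

scale-reflect : ∀ c {X Y X′ Y′} → X * Y ≡ - (X′ * Y′) → c * X * Y ≡ - c * X′ * Y′
scale-reflect c {X} {Y} {X′} {Y′} XY≡-X′Y′ = begin
  c * X * Y             ≡⟨ *-assoc c X Y ⟩
  c * (X * Y)           ≡⟨ cong (c *_) XY≡-X′Y′ ⟩
  c * - (X′ * Y′)       ≡⟨ move-sign c X′ Y′ ⟩
  - c * X′ * Y′         ∎
  where
  open ≡-Reasoning
  move-sign : ∀ c X Y → c * - (X * Y) ≡ - c * X * Y
  move-sign = solve-∀ ℚ-ring

negate-reflected : ∀ c {F X Y X′ Y′} → F ≡ c * X * Y → X * Y ≡ - (X′ * Y′) → - F ≡ c * X′ * Y′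
negate-reflected c {X′ = X′} {Y′} F≡cXY XY≡-X′Y′ =
  trans (cong -_ (trans F≡cXY (scale-reflect c XY≡-X′Y′))) (cancel-signs c X′ Y′)
  where
  cancel-signs : ∀ c X Y → - (- c * X * Y) ≡ c * X * Y
  cancel-signs = solve-∀ ℚ-ring

y≡-x-c : ∀ x y c → x + y + c ≡ 0ℚ → y ≡ - x - c
y≡-x-c x y c x+y+c≡0 =
  trans (isolate x y c) (trans (cong (λ t → t - x - c) x+y+c≡0) (cong (λ t → t - c) (+-identityˡ (- x))))
  where
  isolate : ∀ x y c → y ≡ x + y + c - x - c
  isolate = solve-∀ ℚ-ring

negate-line : ∀ x y c → x + y - c ≡ 0ℚ → - x + - y + c ≡ 0ℚ
negate-line x y c x+y-c≡0 = trans (negate x y c) (cong -_ x+y-c≡0)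
  where
  negate : ∀ x y c → - x + - y + c ≡ - (x + y - c)
  negate = solve-∀ ℚ-ring

part-a : ∀ i m x y → y ≡ - x - ℕ→ℚ m →
    (ℕ→ℚ 2 * ftilde m i x y ≡ constA i m * ff (x + ℕ→ℚ (2 ℕ.* m ℕ.+ i)) (3 ℕ.* m ℕ.+ 2 ℕ.* i ℕ.+ 1) * ff (x + ℕ→ℚ m - ½) m)
  × (ℕ→ℚ 2 * ftilde m i x y ≡ (- constA i m) * ff (y + ℕ→ℚ (2 ℕ.* m ℕ.+ i)) (3 ℕ.* m ℕ.+ 2 ℕ.* i ℕ.+ 1) * ff (y + ℕ→ℚ m - ½) m)
part-a i m x .(- x - ℕ→ℚ m) refl =
  twice-ftilde-on-line i m x , trans (twice-ftilde-on-line i m x) (scale-reflect (constA i m) (neg-swap (rhs-a-on-line i m x)))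

proposition3 : (i m : ℕ) →
    (∃ λ (A : ℚ) → ∀ (x y : ℚ) → x + y + ℕ→ℚ m ≡ 0ℚ →
      ((ℕ→ℚ 2 * ftilde m i x y ≡ A * ff (x + ℕ→ℚ (2 ℕ.* m ℕ.+ i)) (3 ℕ.* m ℕ.+ 2 ℕ.* i ℕ.+ 1) * ff (x + ℕ→ℚ m - ½) m)
      × (ℕ→ℚ 2 * ftilde m i x y ≡ (- A) * ff (y + ℕ→ℚ (2 ℕ.* m ℕ.+ i)) (3 ℕ.* m ℕ.+ 2 ℕ.* i ℕ.+ 1) * ff (y + ℕ→ℚ m - ½) m)))
    ×
    (∃ λ (B : ℚ) → ∀ (x y : ℚ) → x + y - ℕ→ℚ m ≡ 0ℚ →
      ((ℕ→ℚ 2 * ftilde m i x y ≡ B * ff (x + ℕ→ℚ (m ℕ.+ i)) (3 ℕ.* m ℕ.+ 2 ℕ.* i ℕ.+ 1) * ff (x - ½) m)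
      × (ℕ→ℚ 2 * ftilde m i x y ≡ (- B) * ff (y + ℕ→ℚ (m ℕ.+ i)) (3 ℕ.* m ℕ.+ 2 ℕ.* i ℕ.+ 1) * ff (y - ½) m)))
proposition3 i m =
  (constA i m , λ x y x+y+m≡0 → part-a i m x y (y≡-x-c x y (ℕ→ℚ m) x+y+m≡0)) ,
  (constA i m , λ x y x+y-m≡0 →
    let (x-form , y-form) = part-a i m (- x) (- y) (y≡-x-c (- x) (- y) (ℕ→ℚ m) (negate-line x y (ℕ→ℚ m) x+y-m≡0)) in
    trans (twice-ftilde-neg m i x y) (negate-reflected (constA i m) x-form (rhs-a-neg i m x)) ,
    trans (twice-ftilde-neg m i x y) (negate-reflected (- constA i m) y-form (rhs-a-neg i m y)))
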